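{- There is a family of single-headed graphs $\{G_k : k\ge 2\}$ such that $G_k$ has $\Theta(k)$ edges and $p(G_k)=\Theta(k)$.
   Context: All graphs are finite, simple, undirected. A directed 3-hypergraph $H=(V,F)$ consists of hyperarcs $u,v\to w$ (body $\{u,v\}$ of two distinct vertices, head $w$). The closure $cl_H(S)$ of $S\subseteq V$ is obtained by forward chaining: mark $S$; while some hyperarc $a,b\to c$ has $a,b$ marked and $c$ unmarked, mark $c$. $H$ represents $G=(V,E)$ if for all distinct $u,v$: $(u,v)\in E\Rightarrow cl_H(\{u,v\})=V$ and $(u,v)\notin E\Rightarrow cl_H(\{u,v\})=\{u,v\}$. The hydra number $h(G)$ is the minimum number of hyperarcs of a directed 3-hypergraph on $V$ representing $G$; $G$ is single-headed if $h(G)=|E(G)|$. $L(X)$ denotes the line graph of $X$, $pcn(X)$ the minimum number of vertex-disjoint paths covering the vertices of $X$, and $p(G)=\min\{pcn(L(G')): G' \text{ a spanning (not necessarily connected) subgraph of } G \text{ with no isolated vertices}\}$. -}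

module Defs where

open import Data.Nat using (ℕ; _<_; _≤_; _<ᵇ_)
open import Data.Fin using (Fin; toℕ)
open import Data.Bool using (Bool; true; false; T; _∧_)
open import Data.Bool.Properties using (T?)
open import Data.Product using (Σ; Σ-syntax; ∃; ∃-syntax; _×_; _,_)
open import Data.Sum using (_⊎_)
open import Data.List using (List; []; _∷_; [_]; length; filter; cartesianProduct; allFin; concat)
open import Data.List.Relation.Unary.All using (All)
open import Data.List.Membership.Propositional using (_∈_)
open import Data.List.Relation.Unary.Unique.Propositional using (Unique)
open import Data.List.Relation.Binary.Permutation.Propositional using (_↭_)
open import Relation.Binary.PropositionalEquality using (_≡_; _≢_)

record Graph (n : ℕ) : Set where
  field
    adj   : Fin n → Fin n → Bool
    sym   : ∀ u v → adj u v ≡ adj v u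
    irrefl : ∀ u → adj u u ≡ false
open Graph public

Edge : ℕ → Set
Edge n = Fin n × Fin n

-- an edge {i,j} is stored once, as (i , j) with i < j
edgeB : ∀ {n} → Graph n → Edge n → Bool
edgeB G (i , j) = (toℕ i <ᵇ toℕ j) ∧ adj G i j

edges : ∀ {n} → Graph n → List (Edge n)
edges {n} G = filter (λ e → T? (edgeB G e)) (cartesianProduct (allFin n) (allFin n))

numEdges : ∀ {n} → Graph n → ℕ
numEdges G = length (edges G)

-- Directed 3-hypergraphs: hyperarcs a , b → c with body {a,b}, a ≠ b.
-- The body is unordered, so a hyperarc is stored as (a , b , c) with a < b;
-- a hypergraph is a duplicate-free list of hyperarcs (a set F).

Hyperarc : ℕ → Set
Hyperarc n = Fin n × Fin n × Fin n

WFHyper : ∀ {n} → List (Hyperarc n) → Set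
WFHyper H = All (λ { (a , b , c) → toℕ a < toℕ b }) H × Unique H

data InClosure {n} (H : List (Hyperarc n)) (S : Fin n → Set) : Fin n → Set where
  base : ∀ {x} → S x → InClosure H S x
  step : ∀ {a b c} → (a , b , c) ∈ H →
         InClosure H S a → InClosure H S b → InClosure H S c

Pair : ∀ {n} → Fin n → Fin n → Fin n → Set
Pair u v x = x ≡ u ⊎ x ≡ v

Represents : ∀ {n} → Graph n → List (Hyperarc n) → Set
Represents {n} G H = ∀ (u v : Fin n) → u ≢ v →
  (adj G u v ≡ true → ∀ x → InClosure H (Pair u v) x) ×
  (adj G u v ≡ false → ∀ x → InClosure H (Pair u v) x → Pair u v x)

-- h(G) = |E(G)|: some representing hypergraph has |E(G)| hyperarcs and
-- every representing hypergraph has at least |E(G)| hyperarcs.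
SingleHeaded : ∀ {n} → Graph n → Set
SingleHeaded {n} G =
  (Σ[ H ∈ List (Hyperarc n) ] WFHyper H × Represents G H × length H ≡ numEdges G) ×
  (∀ (H : List (Hyperarc n)) → WFHyper H → Represents G H → numEdges G ≤ length H)

LAdj : ∀ {n} → Edge n → Edge n → Set
LAdj (a , b) (c , d) =
  ((a ≡ c ⊎ a ≡ d) ⊎ (b ≡ c ⊎ b ≡ d)) × ((a , b) ≢ (c , d))

-- a (nonempty) walk in the line graph, given by its vertex sequence;
-- vertices are distinct in a path cover since the cover is a permutation
-- of the duplicate-free list E(G').
data LPath {n} : List (Edge n) → Set where
  single : ∀ {e} → LPath [ e ]
  cons   : ∀ {e f es} → LAdj e f → LPath (f ∷ es) → LPath (e ∷ f ∷ es)

PathCover : ∀ {n} → Graph n → ℕ → Set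
PathCover {n} G' m = Σ[ ps ∈ List (List (Edge n)) ]
  All LPath ps × (concat ps ↭ edges G') × length ps ≡ m

SpanningSub : ∀ {n} → Graph n → Graph n → Set
SpanningSub {n} G' G = ∀ (u v : Fin n) → adj G' u v ≡ true → adj G u v ≡ true

NoIsolated : ∀ {n} → Graph n → Set
NoIsolated {n} G = ∀ (u : Fin n) → ∃[ v ] adj G u v ≡ true

IsP : ∀ {n} → Graph n → ℕ → Set
IsP {n} G m =
  (Σ[ G' ∈ Graph n ] SpanningSub G' G × NoIsolated G' × PathCover G' m) ×
  (∀ (G' : Graph n) → SpanningSub G' G → NoIsolated G' → ∀ m' → PathCover G' m' → m ≤ m')

-- G k is a cycle of 2k seven-vertex pockets U, S₁, S₂, X, Y, X′, Y′ (edges U S₁, U S₂, S₁ X, S₁ Y,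
-- S₂ X, S₂ Y, X X′, Y Y′) whose hubs U are joined cyclically. One hyperarc per edge represents it:
-- the heads are chosen so that the two endpoints of any pocket edge generate their whole pocket,
-- and U S₂ followed by the hub link generates the next pocket, so the closure runs around the
-- cycle. Every edge has to be the body of some hyperarc (a third vertex must be fired from it),
-- hence h(G) = |E|.
-- A spanning subgraph without isolated vertices contains both leaf edges X X′ and Y Y′ of every
-- pocket. A finite search over the traces a path cover leaves in one pocket shows that no cover
-- passes through both leaf edges unless one of its paths ends at a pocket edge away from the hub.
-- So each of the 2k pockets holds a path end and p(G) ≥ k; the k paths that sweep through two
-- consecutive pockets and the hub link between them attain this.
module Submission where

open import Defs
open import Data.Nat using (ℕ; zero; suc; _+_; _*_; _∸_; _≤_; _<_; z≤n; s≤s; _<ᵇ_)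
open import Data.Nat.Properties using (<ᵇ⇒<; <⇒<ᵇ; <-irrefl; <-asym)
import Data.Nat.Properties as ℕ
open import Data.Fin as Fin using (Fin; toℕ; zero; suc)
import Data.Fin.Properties as Fin
open import Data.Fin.Properties using (toℕ-injective)
open import Data.Bool as Bool using (Bool; true; false; T; _∧_; _∨_; not; if_then_else_)
open import Data.Bool.Properties using (T?; ∨-comm; T-∧)
open import Data.Product using (Σ; Σ-syntax; ∃; _×_; _,_; proj₁; proj₂)
import Data.Product as Product
open import Data.Product.Properties using (≡-dec)
open import Data.Sum using (_⊎_; inj₁; inj₂; [_,_]′)
import Data.Sum as Sum
open import Data.Maybe using (Maybe; just; nothing)
import Data.Maybe.Properties as Maybe
open import Data.Vec using (Vec; []; _∷_; lookup; _[_]≔_; replicate)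
open import Data.Vec.Properties using (lookup∘update; lookup∘update′; lookup-replicate)
open import Data.Empty using (⊥; ⊥-elim)
open import Data.Unit using (tt)
open import Function using (_∘_; case_of_)
open import Function.Bundles using (Equivalence; mk⇔)
open import Data.List using (List; []; _∷_; length; cartesianProduct; allFin; concat; map; _++_; catMaybes; upTo; reverse)
open import Data.List.Properties using (length-map; length-++; length-tabulate; map-++)
open import Data.List.Relation.Unary.All as All using (All; []; _∷_)
import Data.List.Relation.Unary.All.Properties as All
open import Data.List.Relation.Unary.Any using (here; there; any?)
open import Data.List.Relation.Unary.Any.Properties using (reverse⁺)
open import Data.List.Membership.Propositional using (_∈_; _∉_; find; lose)
open import Data.List.Membership.Propositional.Properties
  using (∈-map⁺; ∈-map⁻; ∈-filter⁺; ∈-filter⁻; ∈-cartesianProduct⁺; ∈-allFin; ∈-∃++; ∈-concat⁺′; ∈-concat⁻′;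
         ∈-++⁺ˡ; ∈-++⁺ʳ; ∈-++⁻)
import Data.List.Membership.DecPropositional as DecMembership
open import Data.List.Membership.Propositional.Properties.WithK using (unique∧set⇒bag)
open import Data.List.Relation.Binary.BagAndSetEquality using (∼bag⇒↭)
open import Data.List.Relation.Unary.Unique.Propositional using (Unique)
import Data.List.Relation.Unary.Unique.Propositional.Properties as Unique
open import Data.List.Relation.Unary.AllPairs using ([]; _∷_)
open import Data.List.Relation.Binary.Permutation.Propositional using (_↭_; ↭-sym; ↭⇒↭ₛ)
open import Data.List.Relation.Binary.Permutation.Propositional.Properties using (∈-resp-↭)
import Data.List.Relation.Binary.Permutation.Setoid.Properties as PermutationSetoid
open import Relation.Binary.PropositionalEquality as ≡
  using (_≡_; _≢_; refl; trans; cong; cong₂; subst; subst₂; module ≡-Reasoning)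
open import Relation.Binary.Definitions using (tri<; tri≈; tri>)
open import Relation.Nullary using (¬_; Dec; yes; no; does; ¬?; _×-dec_; _⊎-dec_)
open import Relation.Nullary.Decidable using (dec-true; dec-false)

false≢true : false ≢ true
false≢true ()

¬true⇒false : ∀ {b} → ¬ (b ≡ true) → b ≡ false
¬true⇒false {true}  b≢true = ⊥-elim (b≢true refl)
¬true⇒false {false} _      = refl

∨-true : ∀ a {b} → a ∨ b ≡ true → a ≡ true ⊎ b ≡ true
∨-true true  _      = inj₁ refl
∨-true false b≡true = inj₂ b≡true

does-true : ∀ {p} {P : Set p} (P? : Dec P) → does P? ≡ true → P
does-true (yes p) _ = p

T-∧⁻ : ∀ a {b} → T (a ∧ b) → T a × T b
T-∧⁻ a = Equivalence.to (T-∧ {a})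

_≡ᵇ_ : ∀ {n} → Fin n → Fin n → Bool
i ≡ᵇ j = does (i Fin.≟ j)

≡ᵇ-refl : ∀ {n} (i : Fin n) → (i ≡ᵇ i) ≡ true
≡ᵇ-refl i = dec-true (i Fin.≟ i) refl

≡ᵇ-≢ : ∀ {n} {i j : Fin n} → i ≢ j → (i ≡ᵇ j) ≡ false
≡ᵇ-≢ {i = i} {j} = dec-false (i Fin.≟ j)

≡ᵇ-sym : ∀ {n} (i j : Fin n) → (i ≡ᵇ j) ≡ (j ≡ᵇ i)
≡ᵇ-sym i j with i Fin.≟ j
... | yes refl = ≡.sym (≡ᵇ-refl i)
... | no i≢j   = ≡.sym (≡ᵇ-≢ (i≢j ∘ ≡.sym))

length-≤-⊆ : ∀ {a} {A : Set a} {xs ys : List A} →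
             Unique xs → (∀ {x} → x ∈ xs → x ∈ ys) → length xs ≤ length ys
length-≤-⊆ {xs = []} _ _ = z≤n
length-≤-⊆ {xs = x ∷ xs} {ys} (x∉xs ∷ uxs) xs⊆ys with ∈-∃++ (xs⊆ys (here refl))
... | ys₁ , ys₂ , refl = begin
  suc (length xs)               ≤⟨ s≤s (length-≤-⊆ uxs xs⊆ys₁++ys₂) ⟩
  suc (length (ys₁ ++ ys₂))     ≡⟨ cong suc (length-++ ys₁) ⟩
  suc (length ys₁ + length ys₂) ≡⟨ ℕ.+-suc (length ys₁) (length ys₂) ⟨
  length ys₁ + length (x ∷ ys₂) ≡⟨ length-++ ys₁ ⟨
  length (ys₁ ++ x ∷ ys₂)       ∎
  where
  open ℕ.≤-Reasoning
  drop-x : ∀ {z} zs → z ∈ zs ++ x ∷ ys₂ → z ≢ x → z ∈ zs ++ ys₂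
  drop-x []       (here refl) z≢x = ⊥-elim (z≢x refl)
  drop-x []       (there z∈)  _   = z∈
  drop-x (_ ∷ zs) (here refl) _   = here refl
  drop-x (_ ∷ zs) (there z∈)  z≢x = there (drop-x zs z∈ z≢x)
  xs⊆ys₁++ys₂ : ∀ {z} → z ∈ xs → z ∈ ys₁ ++ ys₂
  xs⊆ys₁++ys₂ z∈xs = drop-x ys₁ (xs⊆ys (there z∈xs)) (λ { refl → All.lookup x∉xs z∈xs refl })

length-concat-map : ∀ {a b} {A : Set a} {B : Set b} (f : A → List B) {c} →
                    (∀ x → length (f x) ≡ c) → ∀ xs → length (concat (map f xs)) ≡ c * length xs
length-concat-map f {c} _     []       = ≡.sym (ℕ.*-zeroʳ c)
length-concat-map f {c} |f|≡c (x ∷ xs) = begin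
  length (f x ++ concat (map f xs))          ≡⟨ length-++ (f x) ⟩
  length (f x) + length (concat (map f xs))  ≡⟨ cong₂ _+_ (|f|≡c x) (length-concat-map f |f|≡c xs) ⟩
  c + c * length xs                          ≡⟨ ℕ.*-suc c (length xs) ⟨
  c * suc (length xs)                        ∎
  where open ≡-Reasoning

length-allFin : ∀ n → length (allFin n) ≡ n
length-allFin n = length-tabulate {n = n} (λ i → i)

catMaybes-++ : ∀ {a} {A : Set a} (xs ys : List (Maybe A)) → catMaybes (xs ++ ys) ≡ catMaybes xs ++ catMaybes ys
catMaybes-++ []             ys = refl
catMaybes-++ (just x ∷ xs)  ys = cong (x ∷_) (catMaybes-++ xs ys)
catMaybes-++ (nothing ∷ xs) ys = catMaybes-++ xs ys

∈-catMaybes⁺ : ∀ {a} {A : Set a} {x : A} {xs} → just x ∈ xs → x ∈ catMaybes xs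
∈-catMaybes⁺                  (here refl) = here refl
∈-catMaybes⁺ {xs = just _ ∷ _}  (there x∈)  = there (∈-catMaybes⁺ x∈)
∈-catMaybes⁺ {xs = nothing ∷ _} (there x∈)  = ∈-catMaybes⁺ x∈

∈-catMaybes-map⁻ : ∀ {a b} {A : Set a} {B : Set b} (σ : A → Maybe B) {y} xs →
                   y ∈ catMaybes (map σ xs) → ∃ λ x → x ∈ xs × σ x ≡ just y
∈-catMaybes-map⁻ σ (x ∷ xs) y∈ with σ x in σx
∈-catMaybes-map⁻ σ (x ∷ xs) (here refl) | just _ = x , here refl , σx
∈-catMaybes-map⁻ σ (x ∷ xs) (there y∈)  | just _  = Product.map₂ (Product.map₁ there) (∈-catMaybes-map⁻ σ xs y∈)
∈-catMaybes-map⁻ σ (x ∷ xs) y∈          | nothing = Product.map₂ (Product.map₁ there) (∈-catMaybes-map⁻ σ xs y∈)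

unique-catMaybes-map : ∀ {a b} {A : Set a} {B : Set b} (σ : A → Maybe B) →
                       (∀ {x x′ y} → σ x ≡ just y → σ x′ ≡ just y → x ≡ x′) →
                       ∀ {xs} → Unique xs → Unique (catMaybes (map σ xs))
unique-catMaybes-map σ σ-inj []                 = []
unique-catMaybes-map σ σ-inj {x ∷ xs} (x∉ ∷ u) with σ x in σx
... | nothing = unique-catMaybes-map σ σ-inj u
... | just y  = All.tabulate y-fresh ∷ unique-catMaybes-map σ σ-inj u
  where
  y-fresh : ∀ {y′} → y′ ∈ catMaybes (map σ xs) → y ≢ y′
  y-fresh y′∈ refl with ∈-catMaybes-map⁻ σ xs y′∈
  ... | x′ , x′∈ , σx′ = All.lookup x∉ x′∈ (σ-inj σx σx′)

-- LAdj e f unfolds to Touching e f × e ≢ f.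
Touching : ∀ {a} {A : Set a} → A × A → A × A → Set a
Touching (a , b) (c , d) = (a ≡ c ⊎ a ≡ d) ⊎ (b ≡ c ⊎ b ≡ d)

touching? : ∀ {n} (x y : Fin n × Fin n) → Dec (Touching x y)
touching? (a , b) (c , d) = ((a Fin.≟ c) ⊎-dec (a Fin.≟ d)) ⊎-dec ((b Fin.≟ c) ⊎-dec (b Fin.≟ d))

Touching-sym : ∀ {a} {A : Set a} {x y : A × A} → Touching x y → Touching y x
Touching-sym (inj₁ (inj₁ refl)) = inj₁ (inj₁ refl)
Touching-sym (inj₁ (inj₂ refl)) = inj₂ (inj₁ refl)
Touching-sym (inj₂ (inj₁ refl)) = inj₁ (inj₂ refl)
Touching-sym (inj₂ (inj₂ refl)) = inj₂ (inj₂ refl)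

Touching-map : ∀ {a b} {A : Set a} {B : Set b} (f : A → B) {x y : A × A} →
               Touching x y → Touching (Product.map f f x) (Product.map f f y)
Touching-map f = Sum.map (Sum.map (cong f) (cong f)) (Sum.map (cong f) (cong f))

Touching-unmap : ∀ {a b} {A : Set a} {B : Set b} (f : A → B) {x y : A × A} →
                 (∀ {u v} → f u ≡ f v → u ≡ v) → Touching (Product.map f f x) (Product.map f f y) → Touching x y
Touching-unmap f f-inj = Sum.map (Sum.map f-inj f-inj) (Sum.map f-inj f-inj)

LAdj-sym : ∀ {n} {e f : Edge n} → LAdj e f → LAdj f e
LAdj-sym (touch , e≢f) = Touching-sym touch , e≢f ∘ ≡.sym

-- Representing a graph with one hyperarc per edge

module _ {n} (G : Graph n) where

  ∈-edges⁺ : ∀ {p q} → toℕ p < toℕ q → adj G p q ≡ true → (p , q) ∈ edges G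
  ∈-edges⁺ {p} {q} p<q pq = ∈-filter⁺ (λ e → T? (edgeB G e)) (∈-cartesianProduct⁺ (∈-allFin p) (∈-allFin q))
    (subst (λ b → T (_ ∧ b)) (≡.sym pq) (Equivalence.from T-∧ (<⇒<ᵇ p<q , tt)))

  ∈-edges⁻ : ∀ {p q} → (p , q) ∈ edges G → toℕ p < toℕ q × adj G p q ≡ true
  ∈-edges⁻ {p} {q} pq∈
    with proj₂ (∈-filter⁻ (λ e → T? (edgeB G e)) {xs = cartesianProduct (allFin n) (allFin n)} pq∈)
  ... | is-edge with toℕ p <ᵇ toℕ q in p<q | adj G p q
  ... | true | true = <ᵇ⇒< _ _ (subst T (≡.sym p<q) tt) , refl

  edges-unique : Unique (edges G)
  edges-unique = Unique.filter⁺ (λ e → T? (edgeB G e))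
                   (Unique.cartesianProduct⁺ (Unique.allFin⁺ n) (Unique.allFin⁺ n))

module _ {n} {H : List (Hyperarc n)} where

  closure-trans : ∀ {S S' : Fin n → Set} → (∀ {y} → S y → InClosure H S' y) →
                  ∀ {x} → InClosure H S x → InClosure H S' x
  closure-trans S⊆ (base s) = S⊆ s
  closure-trans S⊆ (step a∈ a b) = step a∈ (closure-trans S⊆ a) (closure-trans S⊆ b)

  closure-swap : ∀ {u v x} → InClosure H (Pair u v) x → InClosure H (Pair v u) x
  closure-swap = closure-trans λ { (inj₁ e) → base (inj₂ e) ; (inj₂ e) → base (inj₁ e) }

module HeadArcs {n} (G : Graph n) (head : Edge n → Fin n) where

  arcOf : Edge n → Hyperarc n
  arcOf (p , q) = p , q , head (p , q)

  arcs : List (Hyperarc n)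
  arcs = map arcOf (edges G)

  arcs-wf : WFHyper arcs
  arcs-wf = All.map⁺ (All.tabulate (λ e∈ → proj₁ (∈-edges⁻ G e∈)))
          , Unique.map⁺ (λ { {_ , _} {_ , _} refl → refl }) (edges-unique G)

  length-arcs : length arcs ≡ numEdges G
  length-arcs = length-map arcOf (edges G)

  fire : ∀ {S p q} → (p , q) ∈ edges G →
         InClosure arcs S p → InClosure arcs S q → InClosure arcs S (head (p , q))
  fire pq∈ = step (∈-map⁺ arcOf pq∈)

  body-adjacent : ∀ {a b c} → (a , b , c) ∈ arcs → adj G a b ≡ true
  body-adjacent abc∈ with ∈-map⁻ arcOf abc∈
  ... | _ , e∈ , refl = proj₂ (∈-edges⁻ G e∈)

  -- Every body is an edge, so nothing fires from a non-adjacent pair.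
  closure-nonEdge : ∀ u v → adj G u v ≡ false → ∀ x → InClosure arcs (Pair u v) x → Pair u v x
  closure-nonEdge u v uv x (base s) = s
  closure-nonEdge u v uv x (step abc∈ a b)
    with closure-nonEdge u v uv _ a | closure-nonEdge u v uv _ b | body-adjacent abc∈
  ... | inj₁ refl | inj₁ refl | aa = ⊥-elim (false≢true (trans (≡.sym (irrefl G u)) aa))
  ... | inj₁ refl | inj₂ refl | ab = ⊥-elim (false≢true (trans (≡.sym uv) ab))
  ... | inj₂ refl | inj₁ refl | ba = ⊥-elim (false≢true (trans (≡.sym uv) (trans (Graph.sym G u v) ba)))
  ... | inj₂ refl | inj₂ refl | bb = ⊥-elim (false≢true (trans (≡.sym (irrefl G v)) bb))

  represents : (∀ {p q} → (p , q) ∈ edges G → ∀ x → InClosure arcs (Pair p q) x) → Represents G arcs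
  represents spans u v u≢v = full , closure-nonEdge u v
    where
    full : adj G u v ≡ true → ∀ x → InClosure arcs (Pair u v) x
    full uv with ℕ.<-cmp (toℕ u) (toℕ v)
    ... | tri< u<v _ _ = spans (∈-edges⁺ G u<v uv)
    ... | tri≈ _ u≡v _ = ⊥-elim (u≢v (toℕ-injective u≡v))
    ... | tri> _ _ v<u = λ x → closure-swap (spans (∈-edges⁺ G v<u (trans (Graph.sym G v u) uv)) x)

third-vertex : ∀ {m} (u v : Fin (3 + m)) → ∃ λ x → x ≢ u × x ≢ v
third-vertex u v with zero Fin.≟ u | zero Fin.≟ v
... | no 0≢u | no 0≢v = zero , 0≢u , 0≢v
... | yes refl | no _ with suc zero Fin.≟ v
...   | no 1≢v = suc zero , (λ ()) , 1≢v
...   | yes refl = suc (suc zero) , (λ ()) , (λ ())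
third-vertex u v | no _ | yes refl with suc zero Fin.≟ u
...   | no 1≢u = suc zero , 1≢u , (λ ())
...   | yes refl = suc (suc zero) , (λ ()) , (λ ())
third-vertex u v | yes refl | yes refl = suc zero , (λ ()) , (λ ())

-- Whatever leaves {p, q} first is fired by a hyperarc with body {p, q}.
closure-escapes-via-body : ∀ {n} {H : List (Hyperarc n)} → All (λ { (a , b , c) → toℕ a < toℕ b }) H →
  ∀ {p q x} → toℕ p < toℕ q → InClosure H (Pair p q) x → Pair p q x ⊎ ∃ λ c → (p , q , c) ∈ H
closure-escapes-via-body wf p<q (base s) = inj₁ s
closure-escapes-via-body wf p<q (step {c = c} abc∈ a b)
  with closure-escapes-via-body wf p<q a | closure-escapes-via-body wf p<q b
... | inj₂ arc | _ = inj₂ arc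
... | inj₁ _ | inj₂ arc = inj₂ arc
... | inj₁ (inj₁ refl) | inj₁ (inj₁ refl) = ⊥-elim (<-irrefl refl (All.lookup wf abc∈))
... | inj₁ (inj₁ refl) | inj₁ (inj₂ refl) = inj₂ (c , abc∈)
... | inj₁ (inj₂ refl) | inj₁ (inj₁ refl) = ⊥-elim (<-asym p<q (All.lookup wf abc∈))
... | inj₁ (inj₂ refl) | inj₁ (inj₂ refl) = ⊥-elim (<-irrefl refl (All.lookup wf abc∈))

numEdges≤length : ∀ {m} (G : Graph (3 + m)) (H : List (Hyperarc (3 + m))) →
                  WFHyper H → Represents G H → numEdges G ≤ length H
numEdges≤length G H (wf , _) rep =
  subst (numEdges G ≤_) (length-map body H) (length-≤-⊆ (edges-unique G) edge-is-body)
  where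
  body : Hyperarc _ → Edge _
  body (a , b , _) = a , b
  edge-is-body : ∀ {e} → e ∈ edges G → e ∈ map body H
  edge-is-body {p , q} pq∈ with ∈-edges⁻ G pq∈
  ... | p<q , pq with third-vertex p q
  ... | x , x≢p , x≢q with closure-escapes-via-body wf p<q (proj₁ (rep p q (λ { refl → <-irrefl refl p<q })) pq x)
  ... | inj₁ (inj₁ x≡p) = ⊥-elim (x≢p x≡p)
  ... | inj₁ (inj₂ x≡q) = ⊥-elim (x≢q x≡q)
  ... | inj₂ (_ , arc) = ∈-map⁺ body arc

singleHeaded : ∀ {m} (G : Graph (3 + m)) (head : Edge (3 + m) → Fin (3 + m)) →
  (let open HeadArcs G head in ∀ {p q} → (p , q) ∈ edges G → ∀ x → InClosure arcs (Pair p q) x) →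
  SingleHeaded G
singleHeaded G head spans =
  (arcs , arcs-wf , represents spans , length-arcs) , numEdges≤length G
  where open HeadArcs G head

Role : Set
Role = Fin 7

pattern U  = zero
pattern S₁ = suc zero
pattern S₂ = suc (suc zero)
pattern X  = suc (suc (suc zero))
pattern Y  = suc (suc (suc (suc zero)))
pattern X′ = suc (suc (suc (suc (suc zero))))
pattern Y′ = suc (suc (suc (suc (suc (suc zero)))))

isHub : Role → Bool
isHub zero    = true
isHub (suc _) = false

PocketEdge : Set
PocketEdge = Fin 8

pattern U-S₁ = zero
pattern U-S₂ = suc zero
pattern S₁-X = suc (suc zero)
pattern S₁-Y = suc (suc (suc zero))
pattern S₂-X = suc (suc (suc (suc zero)))
pattern S₂-Y = suc (suc (suc (suc (suc zero))))
pattern X-X′ = suc (suc (suc (suc (suc (suc zero)))))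
pattern Y-Y′ = suc (suc (suc (suc (suc (suc (suc zero))))))

ends : PocketEdge → Role × Role
ends U-S₁ = U , S₁
ends U-S₂ = U , S₂
ends S₁-X = S₁ , X
ends S₁-Y = S₁ , Y
ends S₂-X = S₂ , X
ends S₂-Y = S₂ , Y
ends X-X′ = X , X′
ends Y-Y′ = Y , Y′

lo hi : PocketEdge → Role
lo e = proj₁ (ends e)
hi e = proj₂ (ends e)

lo<hi : ∀ e → toℕ (lo e) < toℕ (hi e)
lo<hi U-S₁ = <ᵇ⇒< 0 1 tt
lo<hi U-S₂ = <ᵇ⇒< 0 2 tt
lo<hi S₁-X = <ᵇ⇒< 1 3 tt
lo<hi S₁-Y = <ᵇ⇒< 1 4 tt
lo<hi S₂-X = <ᵇ⇒< 2 3 tt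
lo<hi S₂-Y = <ᵇ⇒< 2 4 tt
lo<hi X-X′ = <ᵇ⇒< 3 5 tt
lo<hi Y-Y′ = <ᵇ⇒< 4 6 tt

edgeBetween? : (r s : Role) → Dec (∃ λ e → ends e ≡ (r , s))
edgeBetween? r s = Fin.any? λ e → ≡-dec Fin._≟_ Fin._≟_ (ends e) (r , s)

pocketAdj : Role → Role → Bool
pocketAdj r s = does (edgeBetween? r s) ∨ does (edgeBetween? s r)

pocketAdj-sym : ∀ r s → pocketAdj r s ≡ pocketAdj s r
pocketAdj-sym r s = ∨-comm (does (edgeBetween? r s)) _

pocketAdj-irrefl : ∀ r → pocketAdj r r ≡ false
pocketAdj-irrefl U  = refl
pocketAdj-irrefl S₁ = refl
pocketAdj-irrefl S₂ = refl
pocketAdj-irrefl X  = refl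
pocketAdj-irrefl Y  = refl
pocketAdj-irrefl X′ = refl
pocketAdj-irrefl Y′ = refl

pocketEdge : Role → Role → Maybe PocketEdge
pocketEdge r s with edgeBetween? r s
... | yes (e , _) = just e
... | no _        = nothing

pocketEdge-sound : ∀ {r s e} → pocketEdge r s ≡ just e → ends e ≡ (r , s)
pocketEdge-sound {r} {s} eq with edgeBetween? r s
pocketEdge-sound refl | yes (_ , ends≡) = ends≡

pocketEdge-ends : ∀ e → pocketEdge (lo e) (hi e) ≡ just e
pocketEdge-ends U-S₁ = refl
pocketEdge-ends U-S₂ = refl
pocketEdge-ends S₁-X = refl
pocketEdge-ends S₁-Y = refl
pocketEdge-ends S₂-X = refl
pocketEdge-ends S₂-Y = refl
pocketEdge-ends X-X′ = refl
pocketEdge-ends Y-Y′ = refl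

pocketAdj-ends : ∀ e → pocketAdj (lo e) (hi e) ≡ true
pocketAdj-ends e = cong (_∨ does (edgeBetween? (hi e) (lo e))) (dec-true (edgeBetween? (lo e) (hi e)) (e , refl))

ends-injective : ∀ {e f} → ends e ≡ ends f → e ≡ f
ends-injective {e} {f} eq = Maybe.just-injective (begin
  just e                    ≡⟨ pocketEdge-ends e ⟨
  pocketEdge (lo e) (hi e)  ≡⟨ cong₂ pocketEdge (cong proj₁ eq) (cong proj₂ eq) ⟩
  pocketEdge (lo f) (hi f)  ≡⟨ pocketEdge-ends f ⟩
  just f                    ∎)
  where open ≡-Reasoning

hi≢U : ∀ e → hi e ≢ U
hi≢U e hi≡U with subst (λ r → toℕ (lo e) < toℕ r) hi≡U (lo<hi e)
... | ()

≢U⇒¬isHub : ∀ {r} → r ≢ U → isHub r ≡ false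
≢U⇒¬isHub {zero}  r≢U = ⊥-elim (r≢U refl)
≢U⇒¬isHub {suc _} _   = refl

leaf-X′ : ∀ {s} → pocketAdj X′ s ≡ true → s ≡ X
leaf-X′ {X}  _ = refl
leaf-X′ {U}  ()
leaf-X′ {S₁} ()
leaf-X′ {S₂} ()
leaf-X′ {Y}  ()
leaf-X′ {X′} ()
leaf-X′ {Y′} ()

leaf-Y′ : ∀ {s} → pocketAdj Y′ s ≡ true → s ≡ Y
leaf-Y′ {Y}  _ = refl
leaf-Y′ {U}  ()
leaf-Y′ {S₁} ()
leaf-Y′ {S₂} ()
leaf-Y′ {X}  ()
leaf-Y′ {X′} ()
leaf-Y′ {Y′} ()

-- A walk is read pocket-wise: nothing stands for an edge outside the pocket.
Sym : Set
Sym = Maybe PocketEdge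

isInner : Sym → Bool
isInner (just e) = not (isHub (lo e))
isInner nothing  = false

touches : Sym → Sym → Bool
touches (just e) (just f) = does (¬? (e Fin.≟ f) ×-dec touching? (ends e) (ends f))
touches _        _        = false

touches-sym : ∀ l s → touches l s ≡ true → touches s l ≡ true
touches-sym (just e) (just f) ef with does-true (¬? (e Fin.≟ f) ×-dec touching? (ends e) (ends f)) ef
... | e≢f , touch = dec-true (¬? (f Fin.≟ e) ×-dec touching? (ends f) (ends e)) (e≢f ∘ ≡.sym , Touching-sym touch)

-- Along a walk in the line graph, an inner edge (one avoiding the hub) can only be followed or
-- preceded by a pocket edge touching it.
compatible : Sym → Sym → Bool
compatible l s = if isInner l ∨ isInner s then touches l s else true

data Compatible : Sym → List Sym → Set where
  done : ∀ {l} → isInner l ≡ false → Compatible l []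
  _∷_  : ∀ {l s w} → compatible l s ≡ true → Compatible s w → Compatible l (s ∷ w)

Visited : Set
Visited = Vec Bool 8

visit : Sym → Visited → Visited
visit (just e) v = v [ e ]≔ true
visit nothing  v = v

seen : Sym → Visited → Bool
seen (just e) v = lookup v e
seen nothing  v = false

-- For each set of visited pocket edges, the last symbols with which it is reached from
-- (∅ , nothing) by compatible steps that never revisit a pocket edge. The table is only used
-- through good-closed and good-safe below, which Agda decides by evaluation.
reachable : Visited → List Sym
reachable (false ∷ false ∷ false ∷ false ∷ false ∷ false ∷ false ∷ false ∷ []) = nothing ∷ []
reachable (false ∷ true ∷ false ∷ false ∷ false ∷ false ∷ false ∷ false ∷ []) = nothing ∷ just U-S₂ ∷ []
reachable (false ∷ true ∷ false ∷ false ∷ false ∷ true ∷ false ∷ false ∷ []) = just S₂-Y ∷ []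
reachable (false ∷ true ∷ false ∷ false ∷ false ∷ true ∷ false ∷ true ∷ []) = just Y-Y′ ∷ []
reachable (false ∷ true ∷ false ∷ false ∷ true ∷ false ∷ false ∷ false ∷ []) = just S₂-X ∷ []
reachable (false ∷ true ∷ false ∷ false ∷ true ∷ false ∷ true ∷ false ∷ []) = just X-X′ ∷ []
reachable (false ∷ true ∷ false ∷ false ∷ true ∷ true ∷ false ∷ false ∷ []) = just S₂-X ∷ just S₂-Y ∷ []
reachable (false ∷ true ∷ false ∷ false ∷ true ∷ true ∷ false ∷ true ∷ []) = just Y-Y′ ∷ []
reachable (false ∷ true ∷ false ∷ false ∷ true ∷ true ∷ true ∷ false ∷ []) = just X-X′ ∷ []
reachable (false ∷ true ∷ false ∷ true ∷ false ∷ true ∷ false ∷ false ∷ []) = just S₁-Y ∷ []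
reachable (false ∷ true ∷ false ∷ true ∷ false ∷ true ∷ false ∷ true ∷ []) = just S₁-Y ∷ just Y-Y′ ∷ []
reachable (false ∷ true ∷ false ∷ true ∷ true ∷ true ∷ false ∷ false ∷ []) = just S₁-Y ∷ []
reachable (false ∷ true ∷ false ∷ true ∷ true ∷ true ∷ false ∷ true ∷ []) = just S₁-Y ∷ just Y-Y′ ∷ []
reachable (false ∷ true ∷ true ∷ false ∷ true ∷ false ∷ false ∷ false ∷ []) = just S₁-X ∷ []
reachable (false ∷ true ∷ true ∷ false ∷ true ∷ false ∷ true ∷ false ∷ []) = just S₁-X ∷ just X-X′ ∷ []
reachable (false ∷ true ∷ true ∷ false ∷ true ∷ true ∷ false ∷ false ∷ []) = just S₁-X ∷ []
reachable (false ∷ true ∷ true ∷ false ∷ true ∷ true ∷ true ∷ false ∷ []) = just S₁-X ∷ just X-X′ ∷ []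
reachable (false ∷ true ∷ true ∷ true ∷ false ∷ true ∷ false ∷ false ∷ []) = just S₁-X ∷ []
reachable (false ∷ true ∷ true ∷ true ∷ false ∷ true ∷ false ∷ true ∷ []) = just S₁-X ∷ []
reachable (false ∷ true ∷ true ∷ true ∷ false ∷ true ∷ true ∷ false ∷ []) = just X-X′ ∷ []
reachable (false ∷ true ∷ true ∷ true ∷ false ∷ true ∷ true ∷ true ∷ []) = just X-X′ ∷ []
reachable (false ∷ true ∷ true ∷ true ∷ true ∷ false ∷ false ∷ false ∷ []) = just S₁-Y ∷ []
reachable (false ∷ true ∷ true ∷ true ∷ true ∷ false ∷ false ∷ true ∷ []) = just Y-Y′ ∷ []
reachable (false ∷ true ∷ true ∷ true ∷ true ∷ false ∷ true ∷ false ∷ []) = just S₁-Y ∷ []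
reachable (false ∷ true ∷ true ∷ true ∷ true ∷ false ∷ true ∷ true ∷ []) = just Y-Y′ ∷ []
reachable (false ∷ true ∷ true ∷ true ∷ true ∷ true ∷ false ∷ false ∷ []) = just S₁-X ∷ just S₁-Y ∷ just S₂-X ∷ just S₂-Y ∷ []
reachable (false ∷ true ∷ true ∷ true ∷ true ∷ true ∷ false ∷ true ∷ []) = just S₁-X ∷ just S₂-X ∷ just S₂-Y ∷ just Y-Y′ ∷ []
reachable (false ∷ true ∷ true ∷ true ∷ true ∷ true ∷ true ∷ false ∷ []) = just S₁-Y ∷ just S₂-X ∷ just S₂-Y ∷ just X-X′ ∷ []
reachable (false ∷ true ∷ true ∷ true ∷ true ∷ true ∷ true ∷ true ∷ []) = just S₂-X ∷ just S₂-Y ∷ just X-X′ ∷ just Y-Y′ ∷ []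
reachable (true ∷ false ∷ false ∷ false ∷ false ∷ false ∷ false ∷ false ∷ []) = nothing ∷ just U-S₁ ∷ []
reachable (true ∷ false ∷ false ∷ true ∷ false ∷ false ∷ false ∷ false ∷ []) = just S₁-Y ∷ []
reachable (true ∷ false ∷ false ∷ true ∷ false ∷ false ∷ false ∷ true ∷ []) = just Y-Y′ ∷ []
reachable (true ∷ false ∷ false ∷ true ∷ false ∷ true ∷ false ∷ false ∷ []) = just S₂-Y ∷ []
reachable (true ∷ false ∷ false ∷ true ∷ false ∷ true ∷ false ∷ true ∷ []) = just S₂-Y ∷ just Y-Y′ ∷ []
reachable (true ∷ false ∷ false ∷ true ∷ true ∷ true ∷ false ∷ false ∷ []) = just S₂-X ∷ []
reachable (true ∷ false ∷ false ∷ true ∷ true ∷ true ∷ false ∷ true ∷ []) = just S₂-X ∷ []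
reachable (true ∷ false ∷ false ∷ true ∷ true ∷ true ∷ true ∷ false ∷ []) = just X-X′ ∷ []
reachable (true ∷ false ∷ false ∷ true ∷ true ∷ true ∷ true ∷ true ∷ []) = just X-X′ ∷ []
reachable (true ∷ false ∷ true ∷ false ∷ false ∷ false ∷ false ∷ false ∷ []) = just S₁-X ∷ []
reachable (true ∷ false ∷ true ∷ false ∷ false ∷ false ∷ true ∷ false ∷ []) = just X-X′ ∷ []
reachable (true ∷ false ∷ true ∷ false ∷ true ∷ false ∷ false ∷ false ∷ []) = just S₂-X ∷ []
reachable (true ∷ false ∷ true ∷ false ∷ true ∷ false ∷ true ∷ false ∷ []) = just S₂-X ∷ just X-X′ ∷ []
reachable (true ∷ false ∷ true ∷ false ∷ true ∷ true ∷ false ∷ false ∷ []) = just S₂-Y ∷ []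
reachable (true ∷ false ∷ true ∷ false ∷ true ∷ true ∷ false ∷ true ∷ []) = just Y-Y′ ∷ []
reachable (true ∷ false ∷ true ∷ false ∷ true ∷ true ∷ true ∷ false ∷ []) = just S₂-Y ∷ []
reachable (true ∷ false ∷ true ∷ false ∷ true ∷ true ∷ true ∷ true ∷ []) = just Y-Y′ ∷ []
reachable (true ∷ false ∷ true ∷ true ∷ false ∷ false ∷ false ∷ false ∷ []) = just S₁-X ∷ just S₁-Y ∷ []
reachable (true ∷ false ∷ true ∷ true ∷ false ∷ false ∷ false ∷ true ∷ []) = just Y-Y′ ∷ []
reachable (true ∷ false ∷ true ∷ true ∷ false ∷ false ∷ true ∷ false ∷ []) = just X-X′ ∷ []
reachable (true ∷ false ∷ true ∷ true ∷ false ∷ true ∷ false ∷ false ∷ []) = just S₂-Y ∷ []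
reachable (true ∷ false ∷ true ∷ true ∷ false ∷ true ∷ false ∷ true ∷ []) = just S₂-Y ∷ just Y-Y′ ∷ []
reachable (true ∷ false ∷ true ∷ true ∷ true ∷ false ∷ false ∷ false ∷ []) = just S₂-X ∷ []
reachable (true ∷ false ∷ true ∷ true ∷ true ∷ false ∷ true ∷ false ∷ []) = just S₂-X ∷ just X-X′ ∷ []
reachable (true ∷ false ∷ true ∷ true ∷ true ∷ true ∷ false ∷ false ∷ []) = just S₁-X ∷ just S₁-Y ∷ just S₂-X ∷ just S₂-Y ∷ []
reachable (true ∷ false ∷ true ∷ true ∷ true ∷ true ∷ false ∷ true ∷ []) = just S₁-X ∷ just S₁-Y ∷ just S₂-X ∷ just Y-Y′ ∷ []
reachable (true ∷ false ∷ true ∷ true ∷ true ∷ true ∷ true ∷ false ∷ []) = just S₁-X ∷ just S₁-Y ∷ just S₂-Y ∷ just X-X′ ∷ []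
reachable (true ∷ false ∷ true ∷ true ∷ true ∷ true ∷ true ∷ true ∷ []) = just S₁-X ∷ just S₁-Y ∷ just X-X′ ∷ just Y-Y′ ∷ []
reachable (true ∷ true ∷ false ∷ false ∷ false ∷ false ∷ false ∷ false ∷ []) = nothing ∷ just U-S₁ ∷ just U-S₂ ∷ []
reachable (true ∷ true ∷ false ∷ false ∷ false ∷ true ∷ false ∷ false ∷ []) = just S₂-Y ∷ []
reachable (true ∷ true ∷ false ∷ false ∷ false ∷ true ∷ false ∷ true ∷ []) = just Y-Y′ ∷ []
reachable (true ∷ true ∷ false ∷ false ∷ true ∷ false ∷ false ∷ false ∷ []) = just S₂-X ∷ []
reachable (true ∷ true ∷ false ∷ false ∷ true ∷ false ∷ true ∷ false ∷ []) = just X-X′ ∷ []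
reachable (true ∷ true ∷ false ∷ false ∷ true ∷ true ∷ false ∷ false ∷ []) = just S₂-X ∷ just S₂-Y ∷ []
reachable (true ∷ true ∷ false ∷ false ∷ true ∷ true ∷ false ∷ true ∷ []) = just Y-Y′ ∷ []
reachable (true ∷ true ∷ false ∷ false ∷ true ∷ true ∷ true ∷ false ∷ []) = just X-X′ ∷ []
reachable (true ∷ true ∷ false ∷ true ∷ false ∷ false ∷ false ∷ false ∷ []) = just S₁-Y ∷ []
reachable (true ∷ true ∷ false ∷ true ∷ false ∷ false ∷ false ∷ true ∷ []) = just Y-Y′ ∷ []
reachable (true ∷ true ∷ false ∷ true ∷ false ∷ true ∷ false ∷ false ∷ []) = nothing ∷ just U-S₁ ∷ just U-S₂ ∷ just S₁-Y ∷ just S₂-Y ∷ []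
reachable (true ∷ true ∷ false ∷ true ∷ false ∷ true ∷ false ∷ true ∷ []) = nothing ∷ just U-S₁ ∷ just U-S₂ ∷ just S₁-Y ∷ just S₂-Y ∷ just Y-Y′ ∷ []
reachable (true ∷ true ∷ false ∷ true ∷ true ∷ true ∷ false ∷ false ∷ []) = nothing ∷ just U-S₁ ∷ just U-S₂ ∷ just S₁-Y ∷ just S₂-X ∷ []
reachable (true ∷ true ∷ false ∷ true ∷ true ∷ true ∷ false ∷ true ∷ []) = nothing ∷ just U-S₁ ∷ just U-S₂ ∷ just S₁-Y ∷ just S₂-X ∷ just Y-Y′ ∷ []
reachable (true ∷ true ∷ false ∷ true ∷ true ∷ true ∷ true ∷ false ∷ []) = just X-X′ ∷ []
reachable (true ∷ true ∷ false ∷ true ∷ true ∷ true ∷ true ∷ true ∷ []) = just X-X′ ∷ []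
reachable (true ∷ true ∷ true ∷ false ∷ false ∷ false ∷ false ∷ false ∷ []) = just S₁-X ∷ []
reachable (true ∷ true ∷ true ∷ false ∷ false ∷ false ∷ true ∷ false ∷ []) = just X-X′ ∷ []
reachable (true ∷ true ∷ true ∷ false ∷ true ∷ false ∷ false ∷ false ∷ []) = nothing ∷ just U-S₁ ∷ just U-S₂ ∷ just S₁-X ∷ just S₂-X ∷ []
reachable (true ∷ true ∷ true ∷ false ∷ true ∷ false ∷ true ∷ false ∷ []) = nothing ∷ just U-S₁ ∷ just U-S₂ ∷ just S₁-X ∷ just S₂-X ∷ just X-X′ ∷ []
reachable (true ∷ true ∷ true ∷ false ∷ true ∷ true ∷ false ∷ false ∷ []) = nothing ∷ just U-S₁ ∷ just U-S₂ ∷ just S₁-X ∷ just S₂-Y ∷ []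
reachable (true ∷ true ∷ true ∷ false ∷ true ∷ true ∷ false ∷ true ∷ []) = just Y-Y′ ∷ []
reachable (true ∷ true ∷ true ∷ false ∷ true ∷ true ∷ true ∷ false ∷ []) = nothing ∷ just U-S₁ ∷ just U-S₂ ∷ just S₁-X ∷ just S₂-Y ∷ just X-X′ ∷ []
reachable (true ∷ true ∷ true ∷ false ∷ true ∷ true ∷ true ∷ true ∷ []) = just Y-Y′ ∷ []
reachable (true ∷ true ∷ true ∷ true ∷ false ∷ false ∷ false ∷ false ∷ []) = just S₁-X ∷ just S₁-Y ∷ []
reachable (true ∷ true ∷ true ∷ true ∷ false ∷ false ∷ false ∷ true ∷ []) = just Y-Y′ ∷ []
reachable (true ∷ true ∷ true ∷ true ∷ false ∷ false ∷ true ∷ false ∷ []) = just X-X′ ∷ []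
reachable (true ∷ true ∷ true ∷ true ∷ false ∷ true ∷ false ∷ false ∷ []) = nothing ∷ just U-S₁ ∷ just U-S₂ ∷ just S₁-X ∷ just S₂-Y ∷ []
reachable (true ∷ true ∷ true ∷ true ∷ false ∷ true ∷ false ∷ true ∷ []) = nothing ∷ just U-S₁ ∷ just U-S₂ ∷ just S₁-X ∷ just S₂-Y ∷ just Y-Y′ ∷ []
reachable (true ∷ true ∷ true ∷ true ∷ false ∷ true ∷ true ∷ false ∷ []) = just X-X′ ∷ []
reachable (true ∷ true ∷ true ∷ true ∷ false ∷ true ∷ true ∷ true ∷ []) = just X-X′ ∷ []
reachable (true ∷ true ∷ true ∷ true ∷ true ∷ false ∷ false ∷ false ∷ []) = nothing ∷ just U-S₁ ∷ just U-S₂ ∷ just S₁-Y ∷ just S₂-X ∷ []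
reachable (true ∷ true ∷ true ∷ true ∷ true ∷ false ∷ false ∷ true ∷ []) = just Y-Y′ ∷ []
reachable (true ∷ true ∷ true ∷ true ∷ true ∷ false ∷ true ∷ false ∷ []) = nothing ∷ just U-S₁ ∷ just U-S₂ ∷ just S₁-Y ∷ just S₂-X ∷ just X-X′ ∷ []
reachable (true ∷ true ∷ true ∷ true ∷ true ∷ false ∷ true ∷ true ∷ []) = just Y-Y′ ∷ []
reachable (true ∷ true ∷ true ∷ true ∷ true ∷ true ∷ false ∷ false ∷ []) = nothing ∷ just U-S₁ ∷ just U-S₂ ∷ just S₁-X ∷ just S₁-Y ∷ just S₂-X ∷ just S₂-Y ∷ []
reachable (true ∷ true ∷ true ∷ true ∷ true ∷ true ∷ false ∷ true ∷ []) = nothing ∷ just U-S₁ ∷ just U-S₂ ∷ just S₁-X ∷ just S₁-Y ∷ just S₂-X ∷ just S₂-Y ∷ just Y-Y′ ∷ []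
reachable (true ∷ true ∷ true ∷ true ∷ true ∷ true ∷ true ∷ false ∷ []) = nothing ∷ just U-S₁ ∷ just U-S₂ ∷ just S₁-X ∷ just S₁-Y ∷ just S₂-X ∷ just S₂-Y ∷ just X-X′ ∷ []
reachable (true ∷ true ∷ true ∷ true ∷ true ∷ true ∷ true ∷ true ∷ []) = just S₁-X ∷ just S₁-Y ∷ just S₂-X ∷ just S₂-Y ∷ just X-X′ ∷ just Y-Y′ ∷ []
reachable _ = []

_∈ᵇ_ : Sym → List Sym → Bool
l ∈ᵇ []       = false
l ∈ᵇ (s ∷ ss) = does (Maybe.≡-dec Fin._≟_ l s) ∨ (l ∈ᵇ ss)

good : Visited → Sym → Bool
good v l = l ∈ᵇ reachable v

everyVec : ∀ {n} → (Vec Bool n → Bool) → Bool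
everyVec {zero}  f = f []
everyVec {suc n} f = everyVec (f ∘ (true ∷_)) ∧ everyVec (f ∘ (false ∷_))

everyVec-sound : ∀ {n} (f : Vec Bool n → Bool) → T (everyVec f) → ∀ v → T (f v)
everyVec-sound {zero}  f t [] = t
everyVec-sound {suc n} f t (true ∷ v)  =
  everyVec-sound (f ∘ (true ∷_)) (proj₁ (T-∧⁻ (everyVec (f ∘ (true ∷_))) t)) v
everyVec-sound {suc n} f t (false ∷ v) =
  everyVec-sound (f ∘ (false ∷_)) (proj₂ (T-∧⁻ (everyVec (f ∘ (true ∷_))) t)) v

everyFin : ∀ {n} → (Fin n → Bool) → Bool
everyFin {zero}  f = true
everyFin {suc n} f = f zero ∧ everyFin (f ∘ suc)

everyFin-sound : ∀ {n} (f : Fin n → Bool) → T (everyFin f) → ∀ i → T (f i)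
everyFin-sound f t zero    = proj₁ (T-∧⁻ (f zero) t)
everyFin-sound f t (suc i) = everyFin-sound (f ∘ suc) (proj₂ (T-∧⁻ (f zero) t)) i

everySym : (Sym → Bool) → Bool
everySym f = f nothing ∧ everyFin (f ∘ just)

everySym-sound : ∀ f → T (everySym f) → ∀ s → T (f s)
everySym-sound f t nothing  = proj₁ (T-∧⁻ (f nothing) t)
everySym-sound f t (just e) = everyFin-sound (f ∘ just) (proj₂ (T-∧⁻ (f nothing) t)) e

_⇒ᵇ_ : Bool → Bool → Bool
a ⇒ᵇ b = not a ∨ b

step-closedᵇ : Visited → Sym → Sym → Bool
step-closedᵇ v l s = (good v l ∧ compatible l s ∧ not (seen s v)) ⇒ᵇ good (visit s v) s

safeᵇ : Visited → Sym → Bool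
safeᵇ v l = not (good v l ∧ not (isInner l) ∧ lookup v X-X′ ∧ lookup v Y-Y′)

good-closed : T (everyVec λ v → everySym λ l → everySym (step-closedᵇ v l))
good-closed = tt

good-safe : T (everyVec λ v → everySym (safeᵇ v))
good-safe = tt

good-step : ∀ v l s → good v l ≡ true → compatible l s ≡ true → seen s v ≡ false → good (visit s v) s ≡ true
good-step v l s vl ls s∉v = modus-ponens vl ls s∉v
  (everySym-sound (step-closedᵇ v l) (everySym-sound (λ l → everySym (step-closedᵇ v l))
    (everyVec-sound (λ v → everySym λ l → everySym (step-closedᵇ v l)) good-closed v) l) s)
  where
  modus-ponens : ∀ {a b c d} → a ≡ true → b ≡ true → c ≡ false → T ((a ∧ b ∧ not c) ⇒ᵇ d) → d ≡ true
  modus-ponens {d = true} refl refl refl _ = refl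

good-end : ∀ v l → good v l ≡ true → isInner l ≡ false →
           lookup v X-X′ ≡ true → lookup v Y-Y′ ≡ true → ⊥
good-end v l vl outer x y =
  contradict vl outer x y (everySym-sound (safeᵇ v) (everyVec-sound (λ v → everySym (safeᵇ v)) good-safe v) l)
  where
  contradict : ∀ {a b c d} → a ≡ true → b ≡ false → c ≡ true → d ≡ true →
               T (not (a ∧ not b ∧ c ∧ d)) → ⊥
  contradict refl refl refl refl ()

private
  unique-tail : ∀ (s : Sym) {w : List Sym} → Unique (catMaybes (s ∷ w)) → Unique (catMaybes w)
  unique-tail (just _) (_ ∷ u) = u
  unique-tail nothing  u       = u

  visit-sees : ∀ e v → lookup (visit (just e) v) e ≡ true
  visit-sees e v = lookup∘update e v true

  visit-mono : ∀ s {e} v → lookup v e ≡ true → lookup (visit s v) e ≡ true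
  visit-mono nothing      v ve = ve
  visit-mono (just f) {e} v ve with e Fin.≟ f
  ... | yes refl = visit-sees e v
  ... | no e≢f   = trans (lookup∘update′ e≢f v true) ve

  visit-seen : ∀ s {e} v → lookup (visit s v) e ≡ true → s ≡ just e ⊎ lookup v e ≡ true
  visit-seen nothing      v ve = inj₂ ve
  visit-seen (just f) {e} v ve with e Fin.≟ f
  ... | yes refl = inj₁ refl
  ... | no e≢f   = inj₂ (trans (≡.sym (lookup∘update′ e≢f v true)) ve)

  unseen : ∀ (s : Sym) {w : List Sym} v → (∀ {e} → lookup v e ≡ true → just e ∉ s ∷ w) → seen s v ≡ false
  unseen nothing  v _ = refl
  unseen (just e) v disjoint with lookup v e in ve
  ... | true  = ⊥-elim (disjoint ve (here refl))
  ... | false = refl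

  disjoint-visit : ∀ (s : Sym) {w : List Sym} v → Unique (catMaybes (s ∷ w)) →
                   (∀ {e} → lookup v e ≡ true → just e ∉ s ∷ w) →
                   ∀ {e} → lookup (visit s v) e ≡ true → just e ∉ w
  disjoint-visit nothing  v _         disjoint ve e∈w = disjoint ve (there e∈w)
  disjoint-visit (just f) v (f∉ ∷ _) disjoint ve e∈w with visit-seen (just f) v ve
  ... | inj₁ refl = All.lookup f∉ (∈-catMaybes⁺ e∈w) refl
  ... | inj₂ ve′  = disjoint ve′ (there e∈w)

-- The invariant: every pocket edge visited so far is recorded in v and does not occur in w.
scan : ∀ {v l w} → good v l ≡ true → Compatible l w → Unique (catMaybes w) →
       (∀ {e} → lookup v e ≡ true → just e ∉ w) →
       lookup v X-X′ ≡ true ⊎ just X-X′ ∈ w → lookup v Y-Y′ ≡ true ⊎ just Y-Y′ ∈ w → ⊥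
scan {v} {l} vl (done outer) _ _ (inj₁ x) (inj₁ y) = good-end v l vl outer x y
scan vl (done _) _ _ (inj₂ ()) _
scan vl (done _) _ _ (inj₁ _) (inj₂ ())
scan {v} {l} {s ∷ w} vl (ls ∷ sw) u disjoint x y =
  scan {visit s v} {s} {w} (good-step v l s vl ls (unseen s v disjoint)) sw (unique-tail s {w} u)
       (disjoint-visit s {w} v u disjoint)
       (carry x) (carry y)
  where
  carry : ∀ {e} → lookup v e ≡ true ⊎ just e ∈ s ∷ w → lookup (visit s v) e ≡ true ⊎ just e ∈ w
  carry (inj₁ ve)         = inj₁ (visit-mono s v ve)
  carry (inj₂ (here refl)) = inj₁ (visit-sees _ v)
  carry (inj₂ (there e∈w)) = inj₂ e∈w

no-walk-through-both-leaves : ∀ {w} → Compatible nothing w → Unique (catMaybes w) →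
                              just X-X′ ∈ w → just Y-Y′ ∈ w → ⊥
no-walk-through-both-leaves c u x y =
  scan {v = replicate 8 false} refl c u (λ {e} ve → ⊥-elim (false≢true (trans (≡.sym (lookup-replicate e false)) ve)))
       (inj₂ x) (inj₂ y)

next : ∀ {K} → Fin K → Fin K
next {suc m} i with suc (toℕ i) ℕ.<? suc m
... | yes i+1<K = Fin.fromℕ< i+1<K
... | no _      = zero

module _ {m : ℕ} where

  toℕ-next : (i : Fin (suc m)) → toℕ i < m → toℕ (next i) ≡ suc (toℕ i)
  toℕ-next i i<m with suc (toℕ i) ℕ.<? suc m
  ... | yes i+1<K = Fin.toℕ-fromℕ< i+1<K
  ... | no i+1≮K  = ⊥-elim (i+1≮K (s≤s i<m))

  next-last : (i : Fin (suc m)) → toℕ i ≡ m → next i ≡ zero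
  next-last i i≡m with suc (toℕ i) ℕ.<? suc m
  ... | yes (s≤s i<m) = ⊥-elim (<-irrefl i≡m i<m)
  ... | no _          = refl

  private
    last-or-not : (i : Fin (suc m)) → toℕ i < m ⊎ toℕ i ≡ m
    last-or-not i = ℕ.m≤n⇒m<n∨m≡n (Fin.toℕ≤pred[n] i)

    walk : (P : Fin (suc m) → Set) → (∀ j → P j → P (next j)) →
           ∀ d j → P j → ∀ j' → toℕ j' ≡ toℕ j + d → P j'
    walk P succ zero j pj j' j'≡j = subst P (toℕ-injective (≡.sym (trans j'≡j (ℕ.+-identityʳ (toℕ j))))) pj
    walk P succ (suc d) j pj j' j'≡j+d+1 =
      walk P succ d (next j) (succ j pj) j'
        (trans j'≡j+d+1 (trans (ℕ.+-suc (toℕ j) d) (cong (_+ d) (≡.sym (toℕ-next j j<m)))))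
      where
      j<m : toℕ j < m
      j<m = ℕ.<-≤-trans (ℕ.m<m+n (toℕ j) (s≤s z≤n)) (subst (_≤ m) j'≡j+d+1 (Fin.toℕ≤pred[n] j'))

  cycle-induction : (P : Fin (suc m) → Set) → ∀ i₀ → P i₀ → (∀ j → P j → P (next j)) → ∀ j → P j
  cycle-induction P i₀ pi₀ succ j = walk P succ (toℕ j) zero p-zero j refl
    where
    p-last : P (Fin.fromℕ m)
    p-last = walk P succ (m ∸ toℕ i₀) i₀ pi₀ (Fin.fromℕ m)
               (trans (Fin.toℕ-fromℕ m) (≡.sym (ℕ.m+[n∸m]≡n (Fin.toℕ≤pred[n] i₀))))
    p-zero : P zero
    p-zero = subst P (next-last (Fin.fromℕ m) (Fin.toℕ-fromℕ m)) (succ _ p-last)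

  next-≢ : 1 ≤ m → (i : Fin (suc m)) → next i ≢ i
  next-≢ 1≤m i next≡i with last-or-not i
  ... | inj₁ i<m = ℕ.1+n≢n (trans (≡.sym (toℕ-next i i<m)) (cong toℕ next≡i))
  ... | inj₂ i≡m = <-irrefl (trans (cong toℕ (trans (≡.sym (next-last i i≡m)) next≡i)) i≡m) 1≤m

  next²-≢ : 2 ≤ m → (i : Fin (suc m)) → next (next i) ≢ i
  next²-≢ 2≤m i next²≡i with last-or-not i
  ... | inj₂ i≡m = <-irrefl 1≡m 2≤m
    where
    1≡m : 1 ≡ m
    1≡m = begin
      1                      ≡⟨ ≡.sym (toℕ-next zero (ℕ.<-≤-trans (s≤s z≤n) 2≤m)) ⟩
      toℕ (next {suc m} zero) ≡⟨ cong (toℕ ∘ next) (≡.sym (next-last i i≡m)) ⟩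
      toℕ (next (next i))     ≡⟨ cong toℕ next²≡i ⟩
      toℕ i                   ≡⟨ i≡m ⟩
      m                       ∎
      where open ≡-Reasoning
  ... | inj₁ i<m with last-or-not (next i)
  ...   | inj₁ i+1<m = <-irrefl i≡i+2 (ℕ.m<n+m (toℕ i) (s≤s z≤n))
    where
    i≡i+2 : toℕ i ≡ 2 + toℕ i
    i≡i+2 = trans (cong toℕ (≡.sym next²≡i)) (trans (toℕ-next (next i) i+1<m) (cong suc (toℕ-next i i<m)))
  ...   | inj₂ i+1≡m = <-irrefl (trans (≡.sym (trans (toℕ-next i i<m) (cong suc i≡0))) i+1≡m) 2≤m
    where
    i≡0 : toℕ i ≡ 0
    i≡0 = trans (cong toℕ (≡.sym next²≡i)) (cong toℕ (next-last (next i) i+1≡m))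

-- A cycle of K pockets, joined through their hubs

module PocketCycle (K : ℕ) where

  N : ℕ
  N = K * 7

  vertex : Fin K → Role → Fin N
  vertex = Fin.combine

  locate : Fin N → Fin K × Role
  locate = Fin.remQuot {K} 7

  locate-vertex : ∀ i r → locate (vertex i r) ≡ (i , r)
  locate-vertex = Fin.remQuot-combine {K} {7}

  vertex-locate : ∀ p → vertex (proj₁ (locate p)) (proj₂ (locate p)) ≡ p
  vertex-locate = Fin.combine-remQuot {K} 7

  vertex-injective : ∀ {i j r s} → vertex i r ≡ vertex j s → i ≡ j × r ≡ s
  vertex-injective {i} {j} {r} {s} = Fin.combine-injective i r j s

  vertex-monoʳ : ∀ i {r s} → toℕ r < toℕ s → toℕ (vertex i r) < toℕ (vertex i s)
  vertex-monoʳ i {r} {s} r<s =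
    subst₂ _<_ (≡.sym (Fin.toℕ-combine i r)) (≡.sym (Fin.toℕ-combine i s)) (ℕ.+-monoʳ-< (7 * toℕ i) r<s)

  vertex-cancelʳ : ∀ i {r s} → toℕ (vertex i r) < toℕ (vertex i s) → toℕ r < toℕ s
  vertex-cancelʳ i {r} {s} lt =
    ℕ.+-cancelˡ-< (7 * toℕ i) _ _ (subst₂ _<_ (Fin.toℕ-combine i r) (Fin.toℕ-combine i s) lt)

  adjacent : Fin K × Role → Fin K × Role → Bool
  adjacent (i , r) (j , s) =
    if i ≡ᵇ j then pocketAdj r s else isHub r ∧ isHub s ∧ (j ≡ᵇ next i ∨ i ≡ᵇ next j)

  adjacent-sym : ∀ a b → adjacent a b ≡ adjacent b a
  adjacent-sym (i , r) (j , s) rewrite ≡ᵇ-sym i j with j ≡ᵇ i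
  ... | true = pocketAdj-sym r s
  ... | false rewrite ∨-comm (j ≡ᵇ next i) (i ≡ᵇ next j) with isHub r | isHub s
  ...   | true  | true  = refl
  ...   | true  | false = refl
  ...   | false | true  = refl
  ...   | false | false = refl

  adjacent-irrefl : ∀ a → adjacent a a ≡ false
  adjacent-irrefl (i , r) rewrite ≡ᵇ-refl i = pocketAdj-irrefl r

  graph : Graph N
  graph = record
    { adj    = λ p q → adjacent (locate p) (locate q)
    ; sym    = λ p q → adjacent-sym (locate p) (locate q)
    ; irrefl = λ p → adjacent-irrefl (locate p)
    }

  adj-vertex : ∀ i r j s → adj graph (vertex i r) (vertex j s) ≡ adjacent (i , r) (j , s)
  adj-vertex i r j s = cong₂ adjacent (locate-vertex i r) (locate-vertex j s)

  same-pocket : ∀ i r s → adjacent (i , r) (i , s) ≡ pocketAdj r s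
  same-pocket i r s rewrite ≡ᵇ-refl i = refl

  pocket : Fin K → PocketEdge → Edge N
  pocket i e = vertex i (lo e) , vertex i (hi e)

  pocket∈edges : ∀ i e → pocket i e ∈ edges graph
  pocket∈edges i e = ∈-edges⁺ graph (vertex-monoʳ i (lo<hi e))
    (trans (adj-vertex i (lo e) i (hi e)) (trans (same-pocket i (lo e) (hi e)) (pocketAdj-ends e)))

  data EdgeView : Edge N → Set where
    inPocket : ∀ i e → EdgeView (pocket i e)
    link        : ∀ i → EdgeView (vertex i U , vertex (next i) U)
    link′       : ∀ i → EdgeView (vertex (next i) U , vertex i U)

  unitOf : ∀ {e} → EdgeView e → Fin K
  unitOf (inPocket i _) = i
  unitOf (link i)          = i
  unitOf (link′ i)         = i

  private
    pocketAdj-view : ∀ {r s} → does (edgeBetween? r s) ∨ does (edgeBetween? s r) ≡ true →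
                     (∃ λ e → ends e ≡ (r , s)) ⊎ (∃ λ e → ends e ≡ (s , r))
    pocketAdj-view {r} {s} rs with ∨-true (does (edgeBetween? r s)) rs
    ... | inj₁ rs′ = inj₁ (does-true (edgeBetween? r s) rs′)
    ... | inj₂ sr′ = inj₂ (does-true (edgeBetween? s r) sr′)

    view : ∀ i r j s → toℕ (vertex i r) < toℕ (vertex j s) → adjacent (i , r) (j , s) ≡ true →
           EdgeView (vertex i r , vertex j s)
    view i r j s lt rs with i Fin.≟ j
    view i r .i s lt rs | yes refl with pocketAdj-view {r} {s} rs
    ... | inj₁ (e , ends≡rs) = subst₂ (λ a b → EdgeView (vertex i a , vertex i b))
                                      (cong proj₁ ends≡rs) (cong proj₂ ends≡rs) (inPocket i e)
    ... | inj₂ (e , ends≡sr) = ⊥-elim (<-asym (vertex-cancelʳ i lt)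
        (subst₂ (λ a b → toℕ a < toℕ b) (cong proj₁ ends≡sr) (cong proj₂ ends≡sr) (lo<hi e)))
    view i U j U lt rs | no _ with j Fin.≟ next i
    ... | yes refl = link i
    ... | no _ with i Fin.≟ next j
    ...   | yes refl = link′ j
    ...   | no _ = ⊥-elim (false≢true rs)
    view i U j (suc _) lt () | no _
    view i (suc _) j s lt () | no _

  edge-view : ∀ {e} → e ∈ edges graph → EdgeView e
  edge-view {p , q} pq∈ with ∈-edges⁻ graph pq∈
  ... | p<q , pq = subst₂ (λ a b → EdgeView (a , b)) (vertex-locate p) (vertex-locate q)
      (view _ _ _ _ (subst₂ (λ a b → toℕ a < toℕ b) (≡.sym (vertex-locate p)) (≡.sym (vertex-locate q)) p<q)
            pq)

  pocketHead : Fin K → PocketEdge → Fin N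
  pocketHead i U-S₁ = vertex i X
  pocketHead i U-S₂ = vertex (next i) U
  pocketHead i S₁-X = vertex i X′
  pocketHead i S₁-Y = vertex i U
  pocketHead i S₂-X = vertex i Y
  pocketHead i S₂-Y = vertex i Y′
  pocketHead i X-X′ = vertex i S₂
  pocketHead i Y-Y′ = vertex i S₁

  headFrom : Fin K → Fin K → Maybe PocketEdge → Fin N
  headFrom i j (just e) = pocketHead i e
  headFrom i j nothing  = if j ≡ᵇ next i then vertex j S₁ else vertex i S₁

  arcHead : Fin K × Role → Fin K × Role → Fin N
  arcHead (i , r) (j , s) = headFrom i j (pocketEdge r s)

  head : Edge N → Fin N
  head (p , q) = arcHead (locate p) (locate q)

  head-vertex : ∀ i r j s → head (vertex i r , vertex j s) ≡ headFrom i j (pocketEdge r s)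
  head-vertex i r j s = cong₂ arcHead (locate-vertex i r) (locate-vertex j s)

  head-pocket : ∀ i e → head (pocket i e) ≡ pocketHead i e
  head-pocket i e = trans (head-vertex i (lo e) i (hi e)) (cong (headFrom i i) (pocketEdge-ends e))

  head-link : ∀ i → head (vertex i U , vertex (next i) U) ≡ vertex (next i) S₁
  head-link i = trans (head-vertex i U (next i) U)
                      (cong (if_then vertex (next i) S₁ else vertex i S₁) (≡ᵇ-refl (next i)))

  head-link′ : ∀ i → i ≢ next (next i) → head (vertex (next i) U , vertex i U) ≡ vertex (next i) S₁
  head-link′ i i≢ = trans (head-vertex (next i) U i U)
                          (cong (if_then vertex i S₁ else vertex (next i) S₁) (≡ᵇ-≢ i≢))

  unitEdges : Fin K → List (Edge N)
  unitEdges i = (vertex i U , vertex (next i) U) ∷ (vertex (next i) U , vertex i U) ∷ map (pocket i) (allFin 8)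

  numEdges≤ : numEdges graph ≤ 10 * K
  numEdges≤ = subst (numEdges graph ≤_)
    (trans (length-concat-map unitEdges |unit| (allFin K)) (cong (10 *_) (length-allFin K)))
    (length-≤-⊆ (edges-unique graph) edge∈units)
    where
    |unit| : ∀ i → length (unitEdges i) ≡ 10
    |unit| i = cong (2 +_) (trans (length-map (pocket i) (allFin 8)) (length-allFin 8))
    edge∈units : ∀ {e} → e ∈ edges graph → e ∈ concat (map unitEdges (allFin K))
    edge∈units e∈ = ∈-concat⁺′ (in-unit (edge-view e∈)) (∈-map⁺ unitEdges (∈-allFin _))
      where
      in-unit : ∀ {e} (ev : EdgeView e) → e ∈ unitEdges (unitOf ev)
      in-unit (inPocket i e) = there (there (∈-map⁺ (pocket i) (∈-allFin e)))
      in-unit (link i)          = here refl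
      in-unit (link′ i)         = there (here refl)

  K≤numEdges : K ≤ numEdges graph
  K≤numEdges = subst (_≤ numEdges graph) (trans (length-map leaf (allFin K)) (length-allFin K))
    (length-≤-⊆ (Unique.map⁺ leaf-injective (Unique.allFin⁺ K)) leaf∈edges)
    where
    leaf : Fin K → Edge N
    leaf i = pocket i X-X′
    leaf-injective : ∀ {i j} → leaf i ≡ leaf j → i ≡ j
    leaf-injective eq = proj₁ (vertex-injective (cong proj₁ eq))
    leaf∈edges : ∀ {e} → e ∈ map leaf (allFin K) → e ∈ edges graph
    leaf∈edges e∈ with ∈-map⁻ leaf e∈
    ... | i , _ , refl = pocket∈edges i X-X′

  pocket-injective : ∀ i {e f} → pocket i e ≡ pocket i f → e ≡ f
  pocket-injective i eq = ends-injective (cong₂ _,_ (proj₂ (vertex-injective (cong proj₁ eq)))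
                                                    (proj₂ (vertex-injective (cong proj₂ eq))))

  touching-same-unit : ∀ {i j a b c d} → Touching (vertex i a , vertex i b) (vertex j c , vertex j d) → i ≡ j
  touching-same-unit = [ [ unit-eq , unit-eq ]′ , [ unit-eq , unit-eq ]′ ]′
    where
    unit-eq : ∀ {i j r s} → vertex i r ≡ vertex j s → i ≡ j
    unit-eq = proj₁ ∘ vertex-injective

  pocket-touching : ∀ {i j e f} → Touching (pocket i e) (pocket j f) → i ≡ j × Touching (ends e) (ends f)
  pocket-touching {i} touch with touching-same-unit touch
  ... | refl = refl , Touching-unmap (vertex i) (proj₂ ∘ vertex-injective) touch

  pocket-LAdj : ∀ i e f → touches (just e) (just f) ≡ true → LAdj (pocket i e) (pocket i f)
  pocket-LAdj i e f ef with does-true (¬? (e Fin.≟ f) ×-dec touching? (ends e) (ends f)) ef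
  ... | e≢f , touch = Touching-map (vertex i) touch , e≢f ∘ pocket-injective i

  neighbour-in-pocket : ∀ {i r j s} → isHub r ≡ false → adjacent (i , r) (j , s) ≡ true →
                        j ≡ i × pocketAdj r s ≡ true
  neighbour-in-pocket {i} {r} {j} {s} r-not-hub rs with i Fin.≟ j
  ... | yes refl = refl , rs
  ... | no _ rewrite r-not-hub = ⊥-elim (false≢true rs)

  link-adjacent : ∀ i → next i ≢ i → adjacent (i , U) (next i , U) ≡ true
  link-adjacent i next≢i rewrite ≡ᵇ-≢ (next≢i ∘ ≡.sym) | ≡ᵇ-refl (next i) = refl

  link∈edges : ∀ i → next i ≢ i →
               (vertex i U , vertex (next i) U) ∈ edges graph ⊎ (vertex (next i) U , vertex i U) ∈ edges graph
  link∈edges i next≢i with ℕ.<-cmp (toℕ (vertex i U)) (toℕ (vertex (next i) U))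
  ... | tri< lt _ _ = inj₁ (∈-edges⁺ graph lt (trans (adj-vertex i U (next i) U) (link-adjacent i next≢i)))
  ... | tri≈ _ eq _ = ⊥-elim (next≢i (≡.sym (proj₁ (vertex-injective (toℕ-injective eq)))))
  ... | tri> _ _ gt = inj₂ (∈-edges⁺ graph gt (trans (adj-vertex (next i) U i U)
                        (trans (adjacent-sym (next i , U) (i , U)) (link-adjacent i next≢i))))

-- Single-headedness of a cycle of at least three pockets

module CycleClosure (m : ℕ) (2≤m : 2 ≤ m) where

  open PocketCycle (suc m)
  open HeadArcs graph head

  next≢ : ∀ i → next i ≢ i
  next≢ = next-≢ (ℕ.<-≤-trans (s≤s z≤n) 2≤m)

  module _ {S : Fin N → Set} where

    private
      IC : Fin N → Set
      IC = InClosure arcs S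

    fire-pocket : ∀ i e → IC (vertex i (lo e)) → IC (vertex i (hi e)) → IC (pocketHead i e)
    fire-pocket i e a b = subst IC (head-pocket i e) (fire (pocket∈edges i e) a b)

    fire-link : ∀ i → IC (vertex i U) → IC (vertex (next i) U) → IC (vertex (next i) S₁)
    fire-link i a b with link∈edges i (next≢ i)
    ... | inj₁ e∈ = subst IC (head-link i) (fire e∈ a b)
    ... | inj₂ e∈ = subst IC (head-link′ i (next²-≢ 2≤m i ∘ ≡.sym)) (fire e∈ b a)

    Full : Fin (suc m) → Set
    Full i = ∀ r → IC (vertex i r)

    fill : ∀ i → IC (vertex i U) → IC (vertex i S₁) → Full i
    fill i u s₁ = λ { U → u ; S₁ → s₁ ; S₂ → s₂ ; X → x ; Y → y ; X′ → x′ ; Y′ → y′ }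
      where
      x  = fire-pocket i U-S₁ u s₁
      x′ = fire-pocket i S₁-X s₁ x
      s₂ = fire-pocket i X-X′ x x′
      y  = fire-pocket i S₂-X s₂ x
      y′ = fire-pocket i S₂-Y s₂ y

    fill-next : ∀ i → IC (vertex i U) → IC (vertex (next i) U) → Full (next i)
    fill-next i u u⁺ = fill (next i) u⁺ (fire-link i u u⁺)

    spread : ∀ i → Full i → Full (next i)
    spread i full = fill-next i (full U) (fire-pocket i U-S₂ (full U) (full S₂))

    everything : ∀ i → Full i → ∀ z → IC z
    everything i full z = subst IC (vertex-locate z)
      (cycle-induction Full i full spread (proj₁ (locate z)) (proj₂ (locate z)))

  private
    lo∈ : ∀ {p q} → InClosure arcs (Pair p q) p
    lo∈ = base (inj₁ refl)
    hi∈ : ∀ {p q} → InClosure arcs (Pair p q) q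
    hi∈ = base (inj₂ refl)

  pocket-spans : ∀ i e z → InClosure arcs (Pair (vertex i (lo e)) (vertex i (hi e))) z
  pocket-spans i U-S₁ = everything i (fill i lo∈ hi∈)
  pocket-spans i U-S₂ = everything (next i) (fill-next i lo∈ (fire-pocket i U-S₂ lo∈ hi∈))
  pocket-spans i S₁-X = everything i (fill i u lo∈)
    where x′ = fire-pocket i S₁-X lo∈ hi∈
          s₂ = fire-pocket i X-X′ hi∈ x′
          y  = fire-pocket i S₂-X s₂ hi∈
          u  = fire-pocket i S₁-Y lo∈ y
  pocket-spans i S₁-Y = everything i (fill i (fire-pocket i S₁-Y lo∈ hi∈) lo∈)
  pocket-spans i S₂-X = everything i (fill i u s₁)
    where y  = fire-pocket i S₂-X lo∈ hi∈
          y′ = fire-pocket i S₂-Y lo∈ y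
          s₁ = fire-pocket i Y-Y′ y y′
          u  = fire-pocket i S₁-Y s₁ y
  pocket-spans i S₂-Y = everything i (fill i u s₁)
    where y′ = fire-pocket i S₂-Y lo∈ hi∈
          s₁ = fire-pocket i Y-Y′ hi∈ y′
          u  = fire-pocket i S₁-Y s₁ hi∈
  pocket-spans i X-X′ = everything i (fill i u s₁)
    where s₂ = fire-pocket i X-X′ lo∈ hi∈
          y  = fire-pocket i S₂-X s₂ lo∈
          y′ = fire-pocket i S₂-Y s₂ y
          s₁ = fire-pocket i Y-Y′ y y′
          u  = fire-pocket i S₁-Y s₁ y
  pocket-spans i Y-Y′ = everything i (fill i (fire-pocket i S₁-Y s₁ lo∈) s₁)
    where s₁ = fire-pocket i Y-Y′ lo∈ hi∈

  link-spans : ∀ i z → InClosure arcs (Pair (vertex i U) (vertex (next i) U)) z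
  link-spans i = everything (next i) (fill-next i lo∈ hi∈)

  edges-span : ∀ {p q} → (p , q) ∈ edges graph → ∀ z → InClosure arcs (Pair p q) z
  edges-span pq∈ with edge-view pq∈
  ... | inPocket i e = pocket-spans i e
  ... | link i          = link-spans i
  ... | link′ i         = closure-swap ∘ link-spans i

  pocketCycle-singleHeaded : SingleHeaded graph
  pocketCycle-singleHeaded = singleHeaded graph head edges-span

-- Every pocket holds an end of every path cover

module CoverLowerBound (K : ℕ) where

  open PocketCycle K

  symbolFrom : Fin K → Fin K × Role → Fin K × Role → Sym
  symbolFrom i (j , r) (j′ , s) = if j ≡ᵇ i ∧ j′ ≡ᵇ i then pocketEdge r s else nothing

  symbol : Fin K → Edge N → Sym
  symbol i (p , q) = symbolFrom i (locate p) (locate q)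

  symbol-vertex : ∀ i j r j′ s → symbol i (vertex j r , vertex j′ s) ≡ symbolFrom i (j , r) (j′ , s)
  symbol-vertex i j r j′ s = cong₂ (symbolFrom i) (locate-vertex j r) (locate-vertex j′ s)

  symbol-pocket : ∀ i e → symbol i (pocket i e) ≡ just e
  symbol-pocket i e = begin
    symbol i (pocket i e)
      ≡⟨ symbol-vertex i i (lo e) i (hi e) ⟩
    (if i ≡ᵇ i ∧ i ≡ᵇ i then pocketEdge (lo e) (hi e) else nothing)
      ≡⟨ cong (λ b → if b ∧ b then _ else _) (≡ᵇ-refl i) ⟩
    pocketEdge (lo e) (hi e)
      ≡⟨ pocketEdge-ends e ⟩
    just e
      ∎
    where open ≡-Reasoning

  private
    symbolFrom-just : ∀ i j r j′ s {e} → symbolFrom i (j , r) (j′ , s) ≡ just e →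
                      (vertex j r , vertex j′ s) ≡ pocket i e
    symbolFrom-just i j r j′ s eq with j Fin.≟ i | j′ Fin.≟ i
    ... | yes refl | yes refl = cong₂ (λ a b → vertex i a , vertex i b)
                                  (≡.sym (cong proj₁ (pocketEdge-sound eq))) (≡.sym (cong proj₂ (pocketEdge-sound eq)))
    ... | yes refl | no _ with () ← eq
    ... | no _     | _    with () ← eq

  symbol-just : ∀ i {f e} → symbol i f ≡ just e → f ≡ pocket i e
  symbol-just i {p , q} eq = trans (cong₂ _,_ (≡.sym (vertex-locate p)) (≡.sym (vertex-locate q)))
    (symbolFrom-just i (proj₁ (locate p)) (proj₂ (locate p)) (proj₁ (locate q)) (proj₂ (locate q)) eq)

  private
    inner-just : ∀ l → isInner l ≡ true → ∃ λ t → l ≡ just t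
    inner-just (just t) _ = t , refl

    compatible-intro : ∀ l s → (isInner l ≡ true → touches l s ≡ true) →
                       (isInner s ≡ true → touches s l ≡ true) → compatible l s ≡ true
    compatible-intro l s from-l from-s with isInner l | isInner s
    ... | true  | _     = from-l refl
    ... | false | true  = touches-sym s l (from-s refl)
    ... | false | false = refl

    off-hub : ∀ {i t j j′} → isInner (just t) ≡ true → ¬ Touching (pocket i t) (vertex j U , vertex j′ U)
    off-hub {t = t} inner = [ [ lo≢U ∘ at-U , lo≢U ∘ at-U ]′ , [ hi≢U t ∘ at-U , hi≢U t ∘ at-U ]′ ]′
      where
      lo≢U : lo t ≢ U
      lo≢U lo≡U = false≢true (trans (≡.sym (cong (not ∘ isHub) lo≡U)) inner)
      at-U : ∀ {i j r} → vertex i r ≡ vertex j U → r ≡ U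
      at-U = proj₂ ∘ vertex-injective

    inner-touches : ∀ i {f g} t → symbol i f ≡ just t → isInner (just t) ≡ true →
                    g ∈ edges graph → LAdj f g → touches (just t) (symbol i g) ≡ true
    inner-touches i t eq inner g∈ fg with refl ← symbol-just i eq | edge-view g∈
    ... | inPocket j t′ with pocket-touching {e = t} {t′} (proj₁ fg)
    ...   | refl , touch = subst (λ σ → touches (just t) σ ≡ true) (≡.sym (symbol-pocket i t′))
                             (dec-true (¬? (t Fin.≟ t′) ×-dec touching? (ends t) (ends t′))
                                       ((λ { refl → proj₂ fg refl }) , touch))
    inner-touches i t eq inner g∈ fg | link j  = ⊥-elim (off-hub {i} {t} {j} {next j} inner (proj₁ fg))
    inner-touches i t eq inner g∈ fg | link′ j = ⊥-elim (off-hub {i} {t} {next j} {j} inner (proj₁ fg))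

  symbol-compatible : ∀ i {f g} → f ∈ edges graph → g ∈ edges graph → LAdj f g →
                      compatible (symbol i f) (symbol i g) ≡ true
  symbol-compatible i {f} {g} f∈ g∈ fg =
    compatible-intro (symbol i f) (symbol i g) (from-inner f∈ g∈ fg) (from-inner g∈ f∈ (LAdj-sym fg))
    where
    from-inner : ∀ {f g} → f ∈ edges graph → g ∈ edges graph → LAdj f g →
                 isInner (symbol i f) ≡ true → touches (symbol i f) (symbol i g) ≡ true
    from-inner {f} f∈ g∈ fg inner with inner-just (symbol i f) inner
    ... | t , eq = subst (λ σ → touches σ (symbol i _) ≡ true) (≡.sym eq)
                     (inner-touches i t eq (subst (λ σ → isInner σ ≡ true) eq inner) g∈ fg)

  lastOf : Edge N → List (Edge N) → Edge N
  lastOf e []       = e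
  lastOf _ (e ∷ es) = lastOf e es

  endsOf : List (Edge N) → List (Edge N)
  endsOf []       = []
  endsOf (e ∷ es) = e ∷ lastOf e es ∷ []

  pathEnds : List (List (Edge N)) → List (Edge N)
  pathEnds ps = concat (map endsOf ps)

  length-pathEnds : ∀ ps → length (pathEnds ps) ≤ 2 * length ps
  length-pathEnds []       = z≤n
  length-pathEnds (p ∷ ps) = begin
    length (endsOf p ++ pathEnds ps)          ≡⟨ length-++ (endsOf p) ⟩
    length (endsOf p) + length (pathEnds ps)  ≤⟨ ℕ.+-mono-≤ (at-most-two p) (length-pathEnds ps) ⟩
    2 + 2 * length ps                         ≡⟨ ≡.sym (ℕ.*-suc 2 (length ps)) ⟩
    2 * suc (length ps)                       ∎
    where
    open ℕ.≤-Reasoning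
    at-most-two : ∀ p → length (endsOf p) ≤ 2
    at-most-two []      = z≤n
    at-most-two (_ ∷ _) = ℕ.≤-refl

  -- Path boundaries are read as an edge outside the pocket.
  word : Fin K → List (List (Edge N)) → List Sym
  word i []       = []
  word i (p ∷ ps) = nothing ∷ map (symbol i) p ++ word i ps

  private
    outer-compatible : ∀ l s → isInner l ≡ false → isInner s ≡ false → compatible l s ≡ true
    outer-compatible l s l-outer s-outer rewrite l-outer | s-outer = refl

  path-compatible : ∀ i {e es w} → LPath (e ∷ es) → (∀ {z} → z ∈ e ∷ es → z ∈ edges graph) →
                    Compatible (symbol i (lastOf e es)) w → Compatible (symbol i e) (map (symbol i) es ++ w)
  path-compatible i single                   _     c = c
  path-compatible i {e} {f ∷ es} (cons ef p) ⊆edges c =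
    symbol-compatible i (⊆edges (here refl)) (⊆edges (there (here refl))) ef
    ∷ path-compatible i p (⊆edges ∘ there) c

  word-compatible : ∀ i ps {l} → isInner l ≡ false → All LPath ps →
                    (∀ {z} → z ∈ concat ps → z ∈ edges graph) →
                    (∀ {z} → z ∈ pathEnds ps → isInner (symbol i z) ≡ false) → Compatible l (word i ps)
  word-compatible i []       l-outer _        _ _ = done l-outer
  word-compatible i ([] ∷ _) _       (() ∷ _) _ _
  word-compatible i ((e ∷ es) ∷ ps) {l} l-outer (p ∷ lps) ⊆edges outer =
    outer-compatible l nothing l-outer refl
    ∷ outer-compatible nothing (symbol i e) refl (outer (here refl))
    ∷ path-compatible i p (⊆edges ∘ ∈-++⁺ˡ)
        (word-compatible i ps {symbol i (lastOf e es)} (outer (there (here refl))) lps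
                         (⊆edges ∘ ∈-++⁺ʳ (e ∷ es)) (outer ∘ there ∘ there))

  ∈-word : ∀ i ps {z} → z ∈ concat ps → symbol i z ∈ word i ps
  ∈-word i (p ∷ ps) z∈ with ∈-++⁻ p z∈
  ... | inj₁ z∈p  = there (∈-++⁺ˡ (∈-map⁺ (symbol i) z∈p))
  ... | inj₂ z∈ps = there (∈-++⁺ʳ (map (symbol i) p) (∈-word i ps z∈ps))

  catMaybes-word : ∀ i ps → catMaybes (word i ps) ≡ catMaybes (map (symbol i) (concat ps))
  catMaybes-word i []       = refl
  catMaybes-word i (p ∷ ps) = begin
    catMaybes (map (symbol i) p ++ word i ps)                      ≡⟨ catMaybes-++ (map (symbol i) p) _ ⟩
    catMaybes (map (symbol i) p) ++ catMaybes (word i ps)          ≡⟨ cong (_ ++_) (catMaybes-word i ps) ⟩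
    catMaybes (map (symbol i) p) ++ catMaybes (map (symbol i) (concat ps))
                                                                   ≡⟨ ≡.sym (catMaybes-++ (map (symbol i) p) _) ⟩
    catMaybes (map (symbol i) p ++ map (symbol i) (concat ps))     ≡⟨ cong catMaybes (≡.sym (map-++ (symbol i) p _)) ⟩
    catMaybes (map (symbol i) (p ++ concat ps))                    ∎
    where open ≡-Reasoning

  leaf-forced : ∀ (G′ : Graph N) → SpanningSub G′ graph → NoIsolated G′ →
                ∀ i e → (∀ {s} → pocketAdj (hi e) s ≡ true → s ≡ lo e) → pocket i e ∈ edges G′
  leaf-forced G′ spanning no-isolated i e only-lo with no-isolated (vertex i (hi e))
  ... | w , hi-w = ∈-edges⁺ G′ (vertex-monoʳ i (lo<hi e))
                     (trans (Graph.sym G′ _ _) (subst (λ x → adj G′ (vertex i (hi e)) x ≡ true) w≡lo hi-w))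
    where
    j = proj₁ (locate w)
    s = proj₂ (locate w)
    in-pocket : j ≡ i × pocketAdj (hi e) s ≡ true
    in-pocket = neighbour-in-pocket (≢U⇒¬isHub (hi≢U e))
      (trans (≡.sym (adj-vertex i (hi e) j s))
             (subst (λ x → adj graph (vertex i (hi e)) x ≡ true) (≡.sym (vertex-locate w)) (spanning _ _ hi-w)))
    w≡lo : w ≡ vertex i (lo e)
    w≡lo = trans (≡.sym (vertex-locate w)) (cong₂ vertex (proj₁ in-pocket) (only-lo (proj₂ in-pocket)))

  private
    module EdgePermutation = PermutationSetoid (≡.setoid (Edge N))

  symbol-injective : ∀ i {f f′ e} → symbol i f ≡ just e → symbol i f′ ≡ just e → f ≡ f′
  symbol-injective i σf σf′ = trans (symbol-just i σf) (≡.sym (symbol-just i σf′))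

  inner-path-end : ∀ (G′ : Graph N) → SpanningSub G′ graph → NoIsolated G′ →
                   ∀ ps → All LPath ps → concat ps ↭ edges G′ →
                   ∀ i → ∃ λ z → z ∈ pathEnds ps × isInner (symbol i z) ≡ true
  inner-path-end G′ spanning no-isolated ps paths ps↭G′ i
    with any? (λ z → isInner (symbol i z) Bool.≟ true) (pathEnds ps)
  ... | yes found = find found
  ... | no none   = ⊥-elim (no-walk-through-both-leaves
        (word-compatible i ps refl paths ⊆edges all-ends-outer)
        (subst Unique (≡.sym (catMaybes-word i ps)) (unique-catMaybes-map (symbol i) (symbol-injective i) unique))
        (leaf∈word X-X′ leaf-X′) (leaf∈word Y-Y′ leaf-Y′))
    where
    unique : Unique (concat ps)
    unique = EdgePermutation.Unique-resp-↭ (↭⇒↭ₛ (↭-sym ps↭G′)) (edges-unique G′)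
    ⊆edges : ∀ {z} → z ∈ concat ps → z ∈ edges graph
    ⊆edges {p , q} z∈ with ∈-edges⁻ G′ (∈-resp-↭ ps↭G′ z∈)
    ... | p<q , pq = ∈-edges⁺ graph p<q (spanning p q pq)
    all-ends-outer : ∀ {z} → z ∈ pathEnds ps → isInner (symbol i z) ≡ false
    all-ends-outer z∈ = ¬true⇒false (none ∘ lose z∈)
    leaf∈word : ∀ e → (∀ {s} → pocketAdj (hi e) s ≡ true → s ≡ lo e) → just e ∈ word i ps
    leaf∈word e only-lo = subst (_∈ word i ps) (symbol-pocket i e)
      (∈-word i ps (∈-resp-↭ (↭-sym ps↭G′) (leaf-forced G′ spanning no-isolated i e only-lo)))

  pockets≤2*paths : ∀ (G′ : Graph N) → SpanningSub G′ graph → NoIsolated G′ →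
                    ∀ m′ → PathCover G′ m′ → K ≤ 2 * m′
  pockets≤2*paths G′ spanning no-isolated m′ (ps , paths , ps↭G′ , refl) = begin
    K                          ≡⟨ ≡.sym (trans (length-map chosen (allFin K)) (length-allFin K)) ⟩
    length (map chosen (allFin K)) ≤⟨ length-≤-⊆ (Unique.map⁺ chosen-injective (Unique.allFin⁺ K)) chosen∈ends ⟩
    length (pathEnds ps)       ≤⟨ length-pathEnds ps ⟩
    2 * length ps              ∎
    where
    open ℕ.≤-Reasoning
    chosen : Fin K → Edge N
    chosen i = proj₁ (inner-path-end G′ spanning no-isolated ps paths ps↭G′ i)
    chosen-inner : ∀ i → isInner (symbol i (chosen i)) ≡ true
    chosen-inner i = proj₂ (proj₂ (inner-path-end G′ spanning no-isolated ps paths ps↭G′ i))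
    chosen-unit : ∀ i → ∃ λ t → chosen i ≡ pocket i t
    chosen-unit i = Product.map₂ (symbol-just i) (inner-just (symbol i (chosen i)) (chosen-inner i))
    chosen-injective : ∀ {i j} → chosen i ≡ chosen j → i ≡ j
    chosen-injective {i} {j} eq =
      proj₁ (vertex-injective (cong proj₁ (trans (≡.sym (proj₂ (chosen-unit i))) (trans eq (proj₂ (chosen-unit j))))))
    chosen∈ends : ∀ {z} → z ∈ map chosen (allFin K) → z ∈ pathEnds ps
    chosen∈ends z∈ with ∈-map⁻ chosen z∈
    ... | i , _ , refl = proj₁ (proj₂ (inner-path-end G′ spanning no-isolated ps paths ps↭G′ i))

-- An optimal path cover

even odd : ∀ {k} → Fin k → Fin (k * 2)
even t = Fin.combine t zero
odd  t = Fin.combine t (suc zero)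

next-even : ∀ {k} (t : Fin k) → next (even t) ≡ odd t
next-even {suc k′} t = toℕ-injective (begin
  toℕ (next (even t))   ≡⟨ toℕ-next (even t) 2t<2k+1 ⟩
  suc (toℕ (even t))    ≡⟨ cong suc (Fin.toℕ-combine t zero) ⟩
  suc (2 * toℕ t + 0)   ≡⟨ cong suc (ℕ.+-identityʳ (2 * toℕ t)) ⟩
  suc (2 * toℕ t)       ≡⟨ ℕ.+-comm 1 (2 * toℕ t) ⟩
  2 * toℕ t + 1         ≡⟨ Fin.toℕ-combine t (suc zero) ⟨
  toℕ (odd t)           ∎)
  where
  open ≡-Reasoning
  2t<2k+1 : toℕ (even t) < suc (k′ * 2)
  2t<2k+1 = subst (_< suc (k′ * 2)) (≡.sym (trans (Fin.toℕ-combine t zero) (ℕ.+-identityʳ (2 * toℕ t))))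
    (s≤s (subst (2 * toℕ t ≤_) (ℕ.*-comm 2 k′) (ℕ.*-monoʳ-≤ 2 (Fin.toℕ≤pred[n] t))))

route : List PocketEdge
route = Y-Y′ ∷ S₂-Y ∷ S₂-X ∷ X-X′ ∷ S₁-X ∷ U-S₁ ∷ []

module OptimalCover (k : ℕ) where

  open PocketCycle (k * 2)

  bridge : Fin k → Edge N
  bridge t = vertex (even t) U , vertex (odd t) U

  coverPath : Fin k → List (Edge N)
  coverPath t = map (pocket (even t)) route ++ bridge t ∷ map (pocket (odd t)) (reverse route)

  coverPaths : List (List (Edge N))
  coverPaths = map coverPath (allFin k)

  coverEdges : List (Edge N)
  coverEdges = concat coverPaths

  private
    even≢odd : ∀ t → even {k} t ≢ odd t
    even≢odd t eq with Fin.combine-injectiveʳ t zero t (suc zero) eq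
    ... | ()

  coverPath-LPath : ∀ t → LPath (coverPath t)
  coverPath-LPath t =
    cons (pocket-LAdj a Y-Y′ S₂-Y refl) (cons (pocket-LAdj a S₂-Y S₂-X refl) (cons (pocket-LAdj a S₂-X X-X′ refl)
    (cons (pocket-LAdj a X-X′ S₁-X refl) (cons (pocket-LAdj a S₁-X U-S₁ refl)
    (cons into-bridge (cons out-of-bridge
    (cons (pocket-LAdj b U-S₁ S₁-X refl) (cons (pocket-LAdj b S₁-X X-X′ refl) (cons (pocket-LAdj b X-X′ S₂-X refl)
    (cons (pocket-LAdj b S₂-X S₂-Y refl) (cons (pocket-LAdj b S₂-Y Y-Y′ refl) single)))))))))))
    where
    a = even t
    b = odd t
    into-bridge : LAdj (pocket a U-S₁) (bridge t)
    into-bridge = inj₁ (inj₁ refl) , λ eq → case proj₂ (vertex-injective (cong proj₂ eq)) of λ ()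
    out-of-bridge : LAdj (bridge t) (pocket b U-S₁)
    out-of-bridge = inj₂ (inj₁ refl) , λ eq → even≢odd t (proj₁ (vertex-injective (cong proj₁ eq)))

  bridge∈edges : ∀ t → bridge t ∈ edges graph
  bridge∈edges t = ∈-edges⁺ graph
    (Fin.combine-monoˡ-< U U (subst₂ _<_ (≡.sym (trans (Fin.toℕ-combine t zero) (ℕ.+-identityʳ (2 * toℕ t))))
                                          (≡.sym (Fin.toℕ-combine t (suc zero)))
                                          (ℕ.m<m+n (2 * toℕ t) (s≤s z≤n))))
    (trans (adj-vertex (even t) U (odd t) U)
           (subst (λ j → adjacent (even t , U) (j , U) ≡ true) (next-even t)
                  (link-adjacent (even t) (λ eq → even≢odd t (≡.sym (trans (≡.sym (next-even t)) eq))))))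

  cover⊆graph : ∀ {z} → z ∈ coverEdges → z ∈ edges graph
  cover⊆graph z∈ with ∈-concat⁻′ coverPaths z∈
  ... | path , z∈path , path∈ with ∈-map⁻ coverPath path∈
  ... | t , _ , refl with ∈-++⁻ (map (pocket (even t)) route) z∈path
  ... | inj₁ z∈even with ∈-map⁻ (pocket (even t)) {xs = route} z∈even
  ...   | e , _ , refl = pocket∈edges (even t) e
  cover⊆graph z∈ | path , z∈path , path∈ | t , _ , refl | inj₂ (here refl) = bridge∈edges t
  cover⊆graph z∈ | path , z∈path , path∈ | t , _ , refl | inj₂ (there z∈odd)
    with ∈-map⁻ (pocket (odd t)) {xs = reverse route} z∈odd
  ... | e , _ , refl = pocket∈edges (odd t) e

  -- key numbers the edges of coverPath t as (t , 0), …, (t , 12).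
  position : Fin 2 → Maybe PocketEdge → ℕ
  position zero       (just Y-Y′) = 0
  position zero       (just S₂-Y) = 1
  position zero       (just S₂-X) = 2
  position zero       (just X-X′) = 3
  position zero       (just S₁-X) = 4
  position zero       (just U-S₁) = 5
  position zero       nothing     = 6
  position (suc zero) (just U-S₁) = 7
  position (suc zero) (just S₁-X) = 8
  position (suc zero) (just X-X′) = 9
  position (suc zero) (just S₂-X) = 10
  position (suc zero) (just S₂-Y) = 11
  position (suc zero) (just Y-Y′) = 12
  position _          _           = 13

  keyFrom : Fin (k * 2) × Role → Fin (k * 2) × Role → Fin k × ℕ
  keyFrom (i , r) (_ , s) = proj₁ (Fin.remQuot {k} 2 i) , position (proj₂ (Fin.remQuot {k} 2 i)) (pocketEdge r s)

  key : Edge N → Fin k × ℕ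
  key (p , q) = keyFrom (locate p) (locate q)

  key-vertex : ∀ t b r j s → key (vertex (Fin.combine t b) r , vertex j s) ≡ (t , position b (pocketEdge r s))
  key-vertex t b r j s = trans (cong₂ keyFrom (locate-vertex (Fin.combine t b) r) (locate-vertex j s))
    (cong (λ tb → proj₁ tb , position (proj₂ tb) (pocketEdge r s)) (Fin.remQuot-combine {k} {2} t b))

  key-pockets : ∀ t b es → map key (map (pocket (Fin.combine t b)) es) ≡ map (λ e → t , position b (just e)) es
  key-pockets t b []       = refl
  key-pockets t b (e ∷ es) =
    cong₂ _∷_ (trans (key-vertex t b (lo e) (Fin.combine t b) (hi e))
                     (cong (λ σ → t , position b σ) (pocketEdge-ends e)))
              (key-pockets t b es)

  key-path : ∀ t → map key (coverPath t) ≡ map (t ,_) (upTo 13)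
  key-path t = trans (map-++ key (map (pocket (even t)) route) _)
    (cong₂ _++_ (key-pockets t zero route)
                (cong₂ _∷_ (key-vertex t zero U (odd t) U) (key-pockets t (suc zero) (reverse route))))

  key-cover : ∀ ts → map key (concat (map coverPath ts)) ≡ cartesianProduct ts (upTo 13)
  key-cover []       = refl
  key-cover (t ∷ ts) = trans (map-++ key (coverPath t) _) (cong₂ _++_ (key-path t) (key-cover ts))

  coverEdges-unique : Unique coverEdges
  coverEdges-unique = Unique.map⁻ (subst Unique (≡.sym (key-cover (allFin k)))
                                     (Unique.cartesianProduct⁺ (Unique.allFin⁺ k) (Unique.upTo⁺ 13)))

  _≟ₑ_ : (e f : Edge N) → Dec (e ≡ f)
  _≟ₑ_ = ≡-dec Fin._≟_ Fin._≟_

  open DecMembership _≟ₑ_ using (_∈?_)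

  covered : Fin N → Fin N → Bool
  covered p q = does ((p , q) ∈? coverEdges) ∨ does ((q , p) ∈? coverEdges)

  private
    covered-true : ∀ {p q} → covered p q ≡ true → (p , q) ∈ coverEdges ⊎ (q , p) ∈ coverEdges
    covered-true {p} {q} pq = Sum.map (does-true ((p , q) ∈? coverEdges)) (does-true ((q , p) ∈? coverEdges))
                                           (∨-true (does ((p , q) ∈? coverEdges)) pq)

    cover-ordered : ∀ {p q} → (p , q) ∈ coverEdges → toℕ p < toℕ q
    cover-ordered = proj₁ ∘ ∈-edges⁻ graph ∘ cover⊆graph

  sparse : Graph N
  sparse = record
    { adj    = covered
    ; sym    = λ p q → ∨-comm (does ((p , q) ∈? coverEdges)) _
    ; irrefl = λ p → ¬true⇒false (λ pp → [ no-loop , no-loop ]′ (covered-true pp))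
    }
    where
    no-loop : ∀ {p} → (p , p) ∈ coverEdges → ⊥
    no-loop pp∈ = <-irrefl refl (cover-ordered pp∈)

  sparse⊆cover : ∀ {z} → z ∈ edges sparse → z ∈ coverEdges
  sparse⊆cover {p , q} z∈ with ∈-edges⁻ sparse z∈
  ... | p<q , pq with covered-true pq
  ...   | inj₁ pq∈ = pq∈
  ...   | inj₂ qp∈ = ⊥-elim (<-asym p<q (cover-ordered qp∈))

  cover-covered : ∀ {p q} → (p , q) ∈ coverEdges → covered p q ≡ true
  cover-covered {p} {q} pq∈ = cong (_∨ does ((q , p) ∈? coverEdges)) (dec-true ((p , q) ∈? coverEdges) pq∈)

  cover⊆sparse : ∀ {z} → z ∈ coverEdges → z ∈ edges sparse
  cover⊆sparse z∈ = ∈-edges⁺ sparse (cover-ordered z∈) (cover-covered z∈)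

  sparse-spanning : SpanningSub sparse graph
  sparse-spanning p q pq with covered-true pq
  ... | inj₁ pq∈ = proj₂ (∈-edges⁻ graph (cover⊆graph pq∈))
  ... | inj₂ qp∈ = trans (Graph.sym graph p q) (proj₂ (∈-edges⁻ graph (cover⊆graph qp∈)))

  private
    coveredBy : Role → PocketEdge
    coveredBy U  = U-S₁
    coveredBy S₁ = U-S₁
    coveredBy S₂ = S₂-X
    coveredBy X  = X-X′
    coveredBy Y  = Y-Y′
    coveredBy X′ = X-X′
    coveredBy Y′ = Y-Y′

    coveredBy-ends : ∀ r → lo (coveredBy r) ≡ r ⊎ hi (coveredBy r) ≡ r
    coveredBy-ends U  = inj₁ refl
    coveredBy-ends S₁ = inj₂ refl
    coveredBy-ends S₂ = inj₁ refl
    coveredBy-ends X  = inj₁ refl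
    coveredBy-ends Y  = inj₁ refl
    coveredBy-ends X′ = inj₂ refl
    coveredBy-ends Y′ = inj₂ refl

    coveredBy∈route : ∀ r → coveredBy r ∈ route
    coveredBy∈route U  = there (there (there (there (there (here refl)))))
    coveredBy∈route S₁ = there (there (there (there (there (here refl)))))
    coveredBy∈route S₂ = there (there (here refl))
    coveredBy∈route X  = there (there (there (here refl)))
    coveredBy∈route Y  = here refl
    coveredBy∈route X′ = there (there (there (here refl)))
    coveredBy∈route Y′ = here refl

    pocket∈cover : ∀ i {e} → e ∈ route → pocket i e ∈ coverEdges
    pocket∈cover i {e} e∈ = subst (λ j → pocket j e ∈ coverEdges) (Fin.combine-remQuot {k} 2 i)
                                   (in-path (proj₁ (Fin.remQuot {k} 2 i)) (proj₂ (Fin.remQuot {k} 2 i)))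
      where
      in-path : ∀ t b → pocket (Fin.combine t b) e ∈ coverEdges
      in-path t b = ∈-concat⁺′ (in-half b) (∈-map⁺ coverPath (∈-allFin t))
        where
        in-half : ∀ b → pocket (Fin.combine t b) e ∈ coverPath t
        in-half zero       = ∈-++⁺ˡ (∈-map⁺ (pocket (even t)) e∈)
        in-half (suc zero) = ∈-++⁺ʳ (map (pocket (even t)) route) (there (∈-map⁺ (pocket (odd t)) (reverse⁺ e∈)))

  sparse-noIsolated : NoIsolated sparse
  sparse-noIsolated p = subst (λ x → ∃ λ w → covered x w ≡ true) (vertex-locate p)
                              (partner (proj₁ (locate p)) (proj₂ (locate p)))
    where
    partner : ∀ i r → ∃ λ w → covered (vertex i r) w ≡ true
    partner i r = [ (λ lo≡r → vertex i (hi e) , subst (λ x → covered (vertex i x) (vertex i (hi e)) ≡ true) lo≡r e-covered)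
                  , (λ hi≡r → vertex i (lo e) , subst (λ x → covered (vertex i x) (vertex i (lo e)) ≡ true) hi≡r
                                                       (trans (Graph.sym sparse _ _) e-covered))
                  ]′ (coveredBy-ends r)
      where
      e = coveredBy r
      e-covered : covered (vertex i (lo e)) (vertex i (hi e)) ≡ true
      e-covered = cover-covered (pocket∈cover i (coveredBy∈route r))

  sparse-cover : PathCover sparse k
  sparse-cover = coverPaths
               , All.map⁺ (All.tabulate (λ _ → coverPath-LPath _))
               , ∼bag⇒↭ (unique∧set⇒bag coverEdges-unique (edges-unique sparse) (mk⇔ cover⊆sparse sparse⊆cover))
               , trans (length-map coverPath (allFin k)) (length-allFin k)

pocketCycles : ℕ → Σ ℕ Graph
pocketCycles k = PocketCycle.N (k * 2) , PocketCycle.graph (k * 2)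

pocketCycles-singleHeaded : ∀ k → 2 ≤ k → SingleHeaded (proj₂ (pocketCycles k))
pocketCycles-singleHeaded 1 (s≤s ())
pocketCycles-singleHeaded (suc (suc k′)) _ = CycleClosure.pocketCycle-singleHeaded (3 + k′ * 2) (s≤s (s≤s z≤n))

pocketCycles-numEdges : ∀ k → k ≤ numEdges (proj₂ (pocketCycles k)) × numEdges (proj₂ (pocketCycles k)) ≤ 20 * k
pocketCycles-numEdges k =
  ℕ.≤-trans (ℕ.m≤m*n k 2) (K≤numEdges (k * 2)) ,
  ℕ.≤-trans (numEdges≤ (k * 2)) (ℕ.≤-reflexive (begin
    10 * (k * 2)  ≡⟨ cong (10 *_) (ℕ.*-comm k 2) ⟩
    10 * (2 * k)  ≡⟨ ℕ.*-assoc 10 2 k ⟨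
    20 * k        ∎))
  where
  open PocketCycle using (numEdges≤; K≤numEdges)
  open ≡-Reasoning

pocketCycles-p : ∀ k → IsP (proj₂ (pocketCycles k)) k
pocketCycles-p k = (sparse , sparse-spanning , sparse-noIsolated , sparse-cover) , k≤paths
  where
  open PocketCycle (k * 2) using (graph; N)
  open OptimalCover k
  k≤paths : ∀ (G′ : Graph N) → SpanningSub G′ graph → NoIsolated G′ →
            ∀ m′ → PathCover G′ m′ → k ≤ m′
  k≤paths G′ spanning no-isolated m′ cover = ℕ.*-cancelˡ-≤ 2
    (subst (_≤ 2 * m′) (ℕ.*-comm k 2) (CoverLowerBound.pockets≤2*paths (k * 2) G′ spanning no-isolated m′ cover))

theorem5p1 : Σ[ G ∈ (ℕ → Σ ℕ Graph) ]
    ((∀ k → 2 ≤ k → SingleHeaded (proj₂ (G k))) ×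
    (Σ[ c ∈ ℕ ] Σ[ C ∈ ℕ ] Σ[ N ∈ ℕ ] ∀ k → 2 ≤ k → N ≤ k →
    (k ≤ c * numEdges (proj₂ (G k)) × numEdges (proj₂ (G k)) ≤ C * k) ×
    (Σ[ m ∈ ℕ ] IsP (proj₂ (G k)) m × k ≤ c * m × m ≤ C * k)))
theorem5p1 = pocketCycles , pocketCycles-singleHeaded , 1 , 20 , 0 , λ k _ _ →
  let k≤|E| , |E|≤20k = pocketCycles-numEdges k in
  (subst (k ≤_) (≡.sym (ℕ.*-identityˡ _)) k≤|E| , |E|≤20k) ,
  (k , pocketCycles-p k , ℕ.≤-reflexive (≡.sym (ℕ.*-identityˡ k)) , ℕ.m≤n*m k 20)
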